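{- Let $P=(G,R)$ be a partial field, $n\in\mathbb{N}$, $N=2^n-1$, and let $p=(p_J)_{J\subseteq[n]}\in\mathbf{P}^N(P)$ with representative chosen so that $p_\emptyset=1$. The following are equivalent: \begin{enumerate} \item There exists a skew-symmetric $n\times n$ matrix $A$ with entries in $P$ such that $p_J=\mathrm{Pf}(A_J)$ for all $J\subseteq[n]$. \item $p$ is a strong orthogonal matroid over $P$. \item $p$ is a weak orthogonal matroid over $P$. \end{enumerate}
   Context: A partial field $P=(G,R)$ consists of a commutative ring $R$ with $1$ and a subgroup $G$ of its unit group containing $-1$; elements of $P$ are those of $G\cup\{0\}$; $\mathbf{P}^N(P)$ is the set of nonzero vectors $(p_J)_{J\subseteq[n]}$ with entries in $G\cup\{0\}$ modulo scaling by $G$; all equations are interpreted in $R$. $\Delta$ denotes symmetric difference. For $J\subseteq[n]$, $A_J$ is the principal submatrix with rows and columns $J$ (increasing order). Pfaffian: empty matrix has $\mathrm{Pf}=1$; odd size gives $0$; $\mathrm{Pf}\begin{pmatrix}0&a\\-a&0\end{pmatrix}=a$; for even size $m\ge 4$, $\mathrm{Pf}(A)=\sum_{j=2}^m(-1)^j\mathrm{Pf}(A_{\{1,j\}})\mathrm{Pf}(A_{\{2,\dots,m\}\setminus\{j\}})$. Wick equations: $\sum_{j=1}^{k}(-1)^jX_{J_1\Delta\{i_j\}}X_{J_2\Delta\{i_j\}}=0$ for all $J_1,J_2\subseteq[n]$ with $J_1\Delta J_2=\{i_1<\dots<i_k\}$; the $4$-term Wick equations are those with $k=4$. A strong orthogonal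 matroid over $P$ is a point of $\mathbf{P}^N(P)$ satisfying all Wick equations; a weak orthogonal matroid over $P$ is a point of $\mathbf{P}^N(P)$ satisfying the $4$-term Wick equations whose support $\{J: p_J\ne0\}$ is the set of bases of an orthogonal matroid. An orthogonal matroid on $E$ is a nonempty collection $\mathcal{B}$ of subsets of $E$ such that for all $B_1,B_2\in\mathcal{B}$ and $x_1\in B_1\Delta B_2$ there is $x_2\in B_1\Delta B_2$, $x_2\neq x_1$, with $B_1\Delta\{x_1,x_2\}\in\mathcal{B}$. -}

module Defs where

open import Level using (Level; _⊔_)
open import Algebra.Bundles using (CommutativeRing)
open import Data.Nat using (ℕ; zero; suc)
open import Data.Bool using (Bool; true; false; _xor_; if_then_else_)
open import Data.Fin using (Fin) renaming (zero to fzero; suc to fsuc)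
open import Data.Fin.Subset using (Subset; ⁅_⁆; _∈_; ∣_∣)
open import Data.Vec using (Vec; []; _∷_; zipWith)
open import Data.List using (List; []; _∷_; _++_; map; length)
open import Data.Product using (Σ; ∃; _×_; _,_)
open import Data.Sum using (_⊎_)
open import Relation.Nullary using (¬_)
open import Relation.Binary.PropositionalEquality using (_≡_)

record PartialField (c ℓ g : Level) : Set (Level.suc (c ⊔ ℓ ⊔ g)) where
  field
    commRing : CommutativeRing c ℓ
  open CommutativeRing commRing public
  field
    G         : Carrier → Set g
    G-resp    : ∀ {x y} → x ≈ y → G x → G y
    G-unit    : ∀ {x} → G x → ∃ λ y → x * y ≈ 1#
    G-one     : G 1#
    G-mul     : ∀ {x y} → G x → G y → G (x * y)
    G-inv     : ∀ {x} → G x → ∃ λ y → G y × (x * y ≈ 1#)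
    G-minusOne : G (- 1#)

_Δ_ : ∀ {n} → Subset n → Subset n → Subset n
_Δ_ = zipWith _xor_

elems : ∀ {n} → Subset n → List (Fin n)
elems [] = []
elems (true ∷ s) = fzero ∷ map fsuc (elems s)
elems (false ∷ s) = map fsuc (elems s)

module PF {c ℓ g} (P : PartialField c ℓ g) where
  open PartialField P

  InP : Carrier → Set (ℓ ⊔ g)
  InP x = G x ⊎ (x ≈ 0#)

  signPow : ℕ → Carrier
  signPow zero = 1#
  signPow (suc k) = - signPow k

  -- Pfaffian of the submatrix of A on the (ordered) index list xs, via
  -- Pf(A) = Σ_{j=2}^m (-1)^j A_{1j} Pf(A with rows/cols 1,j deleted).
  -- The ℕ argument is fuel; it is always ≥ the list length, so it never runs out.
  module _ {n : ℕ} (A : Fin n → Fin n → Carrier) where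
    mutual
      pfFuel : ℕ → List (Fin n) → Carrier
      pfFuel _ [] = 1#
      pfFuel zero (_ ∷ _) = 0#
      pfFuel (suc f) (x ∷ xs) = expand f x [] xs 0

      -- expand f x pre post k : sum over y ∈ post, y at position k (0-based)
      -- in pre ++ post, of (-1)^k A_{x y} Pf(pre ++ post without y)
      expand : ℕ → Fin n → List (Fin n) → List (Fin n) → ℕ → Carrier
      expand f x pre [] k = 0#
      expand f x pre (y ∷ post) k =
        (signPow k * (A x y * pfFuel f (pre ++ post)))
          + expand f x (pre ++ (y ∷ [])) post (suc k)

    PfSub : Subset n → Carrier
    PfSub J = pfFuel (length (elems J)) (elems J)

  module _ {n : ℕ} (p : Subset n → Carrier) where
    wickSum : Subset n → Subset n → Carrier
    wickSum J₁ J₂ = go 1 (elems (J₁ Δ J₂))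
      where
      go : ℕ → List (Fin n) → Carrier
      go j [] = 0#
      go j (i ∷ is) = (signPow j * (p (J₁ Δ ⁅ i ⁆) * p (J₂ Δ ⁅ i ⁆))) + go (suc j) is

    AllWick : Set ℓ
    AllWick = ∀ J₁ J₂ → wickSum J₁ J₂ ≈ 0#

    FourTermWick : Set ℓ
    FourTermWick = ∀ J₁ J₂ → ∣ J₁ Δ J₂ ∣ ≡ 4 → wickSum J₁ J₂ ≈ 0#

    Support : Subset n → Set ℓ
    Support J = ¬ (p J ≈ 0#)

  IsOrthogonalMatroid : ∀ {n} {b} → (Subset n → Set b) → Set b
  IsOrthogonalMatroid {n} ℬ =
    (∃ λ B → ℬ B) ×
    (∀ B₁ B₂ → ℬ B₁ → ℬ B₂ → ∀ x₁ → x₁ ∈ (B₁ Δ B₂) →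
      ∃ λ x₂ → x₂ ∈ (B₁ Δ B₂) × ¬ (x₂ ≡ x₁) × ℬ (B₁ Δ (⁅ x₁ ⁆ Δ ⁅ x₂ ⁆)))

  IsPoint : ∀ {n} → (Subset n → Carrier) → Set (ℓ ⊔ g)
  IsPoint {n} p = (∀ J → InP (p J)) × (∃ λ J → ¬ (p J ≈ 0#))

  StrongOM : ∀ {n} → (Subset n → Carrier) → Set (ℓ ⊔ g)
  StrongOM p = IsPoint p × AllWick p

  WeakOM : ∀ {n} → (Subset n → Carrier) → Set (ℓ ⊔ g)
  WeakOM p = IsPoint p × FourTermWick p × IsOrthogonalMatroid (Support p)

  PfaffianRep : ∀ {n} → (Subset n → Carrier) → Set (c ⊔ ℓ ⊔ g)
  PfaffianRep {n} p =
    ∃ λ (A : Fin n → Fin n → Carrier) →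
      (∀ i j → InP (A i j)) × (∀ i j → A i j ≈ - A j i) × (∀ J → p J ≈ PfSub A J)

{-# OPTIONS --safe #-}

-- Write p = Σ_J p_J e_J in the exterior algebra of Rⁿ, with ε_i = e_i ∧ _ and ι_i the contraction by e_i*;
-- they satisfy the canonical anticommutation relations. The Wick sum of p at J₁, J₂ is -Ω(p, p)(J₁, J₂)
-- for the form Ω = Σ_i ε_i ⊗ ι_i + ι_i ⊗ ε_i. For the vector q of principal Pfaffians of a skew matrix A,
-- expansion along a row gives ι_i q = (Σ_j A_ij e_j) ∧ q - A_ii e_i ∧ q, and skewness then makes Ω(q, q)
-- vanish: Pfaffians satisfy every Wick equation. All Wick equations give the exchange axiom, because in the
-- equation for B₁ Δ x₁, B₂ Δ x₁ the x₁-term p_B₁ p_B₂ is nonzero. Conversely, for a weak orthogonal matroid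
-- with p_∅ = 1 take A_ij = ±p_{ij} and show p_J = Pf(A_J) by induction on |J|: odd sets are not bases, the
-- case |J| = 2 is the choice of A, and for |J| ≥ 4 the exchange axiom yields a basis S ⊂ J with |J ∖ S| = 4,
-- whose 4-term Wick equation determines p_J from p_S, a unit, and coordinates on smaller sets.

module Submission where

open import Defs
open import Level using (_⊔_)
open import Algebra.Bundles using (CommutativeRing)
open import Data.Bool using (Bool; true; false; _xor_; if_then_else_)
open import Data.Bool.Properties using (xor-assoc; xor-comm; xor-same; xor-identityʳ; xor-annihilates-not)
open import Data.Fin using (Fin) renaming (zero to fzero; suc to fsuc)
open import Data.Fin.Properties using (_≟_) renaming (suc-injective to fsuc-injective)
open import Data.Fin.Subset using (Subset; ⁅_⁆; _∈_; _∉_; _⊆_; ∣_∣; ⊥; Nonempty)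
open import Data.Fin.Subset.Properties using (drop-∷-⊆; _∈?_; ∉⊥)
open import Data.List using (List; []; _∷_; _++_; map; length)
open import Data.List.Properties using (map-∘; ++-assoc; length-map; map-++)
open import Data.Nat as ℕ using (ℕ; zero; suc; pred; parity; _≤_; _<_; s≤s; z≤n)
open import Data.Nat.Induction using (<-wellFounded)
import Data.Nat.Properties as Nat
open import Data.Parity.Base using (0ℙ; 1ℙ)
open import Data.Product using (Σ; ∃; _×_; _,_; proj₂)
open import Data.Sum using (_⊎_; inj₁; inj₂)
open import Data.Vec using ([]; _∷_; here; there)
open import Function using (_∘_)
open import Function.Bundles using (_⇔_; mk⇔)
open import Induction.WellFounded using (module All)
open import Relation.Binary.PropositionalEquality as ≡ using (_≡_; _≢_)
import Relation.Binary.Construct.On as On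
open import Relation.Nullary using (¬_; Dec; yes; no; contradiction)

-- Symmetric differences of subsets

xor-cancelʳ : ∀ x y z → (x xor z) xor (y xor z) ≡ x xor y
xor-cancelʳ x y false = ≡.cong₂ _xor_ (xor-identityʳ x) (xor-identityʳ y)
xor-cancelʳ x y true = ≡.trans (≡.cong₂ _xor_ (xor-comm x true) (xor-comm y true)) (xor-annihilates-not x y)

Δ-assoc : ∀ {n} (X Y Z : Subset n) → (X Δ Y) Δ Z ≡ X Δ (Y Δ Z)
Δ-assoc [] [] [] = ≡.refl
Δ-assoc (x ∷ X) (y ∷ Y) (z ∷ Z) = ≡.cong₂ _∷_ (xor-assoc x y z) (Δ-assoc X Y Z)

Δ-identityʳ : ∀ {n} (X : Subset n) → X Δ ⊥ ≡ X
Δ-identityʳ [] = ≡.refl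
Δ-identityʳ (x ∷ X) = ≡.cong₂ _∷_ (xor-identityʳ x) (Δ-identityʳ X)

Δ-cancelʳ : ∀ {n} (X Y Z : Subset n) → (X Δ Z) Δ (Y Δ Z) ≡ X Δ Y
Δ-cancelʳ [] [] [] = ≡.refl
Δ-cancelʳ (x ∷ X) (y ∷ Y) (z ∷ Z) = ≡.cong₂ _∷_ (xor-cancelʳ x y z) (Δ-cancelʳ X Y Z)

Δ-involutive : ∀ {n} (X Y : Subset n) → (X Δ Y) Δ Y ≡ X
Δ-involutive [] [] = ≡.refl
Δ-involutive (x ∷ X) (y ∷ Y) =
  ≡.cong₂ _∷_ (≡.trans (xor-assoc x y y) (≡.trans (≡.cong (x xor_) (xor-same y)) (xor-identityʳ x)))
            (Δ-involutive X Y)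

x∈X⇒x∉XΔ⁅x⁆ : ∀ {n} {x : Fin n} {X} → x ∈ X → x ∉ X Δ ⁅ x ⁆
x∈X⇒x∉XΔ⁅x⁆ here ()
x∈X⇒x∉XΔ⁅x⁆ (there x∈X) (there x∈XΔ⁅x⁆) = x∈X⇒x∉XΔ⁅x⁆ x∈X x∈XΔ⁅x⁆

y≢x⇒y∈X⇒y∈XΔ⁅x⁆ : ∀ {n} {x y : Fin n} {X} → y ≢ x → y ∈ X → y ∈ X Δ ⁅ x ⁆
y≢x⇒y∈X⇒y∈XΔ⁅x⁆ {x = fzero} {fzero} y≢x _ with () ← y≢x ≡.refl
y≢x⇒y∈X⇒y∈XΔ⁅x⁆ {x = fzero} {fsuc y} {_ ∷ X} _ (there y∈X) = there (≡.subst (y ∈_) (≡.sym (Δ-identityʳ X)) y∈X)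
y≢x⇒y∈X⇒y∈XΔ⁅x⁆ {x = fsuc x} {fzero} _ here = here
y≢x⇒y∈X⇒y∈XΔ⁅x⁆ {x = fsuc x} {fsuc y} y≢x (there y∈X) = there (y≢x⇒y∈X⇒y∈XΔ⁅x⁆ (λ y≡x → y≢x (≡.cong fsuc y≡x)) y∈X)

y≢x⇒y∈XΔ⁅x⁆⇒y∈X : ∀ {n} {x y : Fin n} {X} → y ≢ x → y ∈ X Δ ⁅ x ⁆ → y ∈ X
y≢x⇒y∈XΔ⁅x⁆⇒y∈X {x = fzero} {fzero} y≢x _ with () ← y≢x ≡.refl
y≢x⇒y∈XΔ⁅x⁆⇒y∈X {x = fzero} {fsuc y} {_ ∷ X} _ (there y∈X) = there (≡.subst (y ∈_) (Δ-identityʳ X) y∈X)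
y≢x⇒y∈XΔ⁅x⁆⇒y∈X {x = fsuc x} {fzero} {true ∷ X} _ here = here
y≢x⇒y∈XΔ⁅x⁆⇒y∈X {x = fsuc x} {fsuc y} {_ ∷ X} y≢x (there y∈X) = there (y≢x⇒y∈XΔ⁅x⁆⇒y∈X (λ y≡x → y≢x (≡.cong fsuc y≡x)) y∈X)

x∈X⇒XΔ⁅x⁆⊆X : ∀ {n} {x : Fin n} {X} → x ∈ X → X Δ ⁅ x ⁆ ⊆ X
x∈X⇒XΔ⁅x⁆⊆X {x = x} x∈X {y} y∈XΔ⁅x⁆ with y ≟ x
... | yes ≡.refl with () ← x∈X⇒x∉XΔ⁅x⁆ x∈X y∈XΔ⁅x⁆
... | no y≢x = y≢x⇒y∈XΔ⁅x⁆⇒y∈X y≢x y∈XΔ⁅x⁆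

x∈XΔY⁻ : ∀ {n} {x : Fin n} X Y → x ∈ X Δ Y → (x ∈ X × x ∉ Y) ⊎ (x ∉ X × x ∈ Y)
x∈XΔY⁻ (true ∷ X) (false ∷ Y) here = inj₁ (here , λ ())
x∈XΔY⁻ (false ∷ X) (true ∷ Y) here = inj₂ ((λ ()) , here)
x∈XΔY⁻ (_ ∷ X) (_ ∷ Y) (there x∈XΔY) with x∈XΔY⁻ X Y x∈XΔY
... | inj₁ (x∈X , x∉Y) = inj₁ (there x∈X , λ { (there x∈Y) → x∉Y x∈Y })
... | inj₂ (x∉X , x∈Y) = inj₂ ((λ { (there x∈X) → x∉X x∈X }) , there x∈Y)

x∉X⇒x∈Y⇒x∈XΔY : ∀ {n} {x : Fin n} {X Y} → x ∉ X → x ∈ Y → x ∈ X Δ Y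
x∉X⇒x∈Y⇒x∈XΔY {X = false ∷ X} x∉X here = here
x∉X⇒x∈Y⇒x∈XΔY {X = true ∷ X} x∉X here with () ← x∉X here
x∉X⇒x∈Y⇒x∈XΔY {X = _ ∷ X} x∉X (there x∈Y) = there (x∉X⇒x∈Y⇒x∈XΔY (λ x∈X → x∉X (there x∈X)) x∈Y)

∣XΔ⁅x⁆∣-∈ : ∀ {n} {x : Fin n} {X} → x ∈ X → suc ∣ X Δ ⁅ x ⁆ ∣ ≡ ∣ X ∣
∣XΔ⁅x⁆∣-∈ {X = true ∷ X} here = ≡.cong (suc ∘ ∣_∣) (Δ-identityʳ X)
∣XΔ⁅x⁆∣-∈ {X = true ∷ X} (there x∈X) = ≡.cong suc (∣XΔ⁅x⁆∣-∈ x∈X)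
∣XΔ⁅x⁆∣-∈ {X = false ∷ X} (there x∈X) = ∣XΔ⁅x⁆∣-∈ x∈X

∣XΔ⁅x⁆∣-∉ : ∀ {n} {x : Fin n} {X} → x ∉ X → ∣ X Δ ⁅ x ⁆ ∣ ≡ suc ∣ X ∣
∣XΔ⁅x⁆∣-∉ {x = fzero} {true ∷ X} x∉X with () ← x∉X here
∣XΔ⁅x⁆∣-∉ {x = fzero} {false ∷ X} x∉X = ≡.cong (suc ∘ ∣_∣) (Δ-identityʳ X)
∣XΔ⁅x⁆∣-∉ {x = fsuc x} {true ∷ X} x∉X = ≡.cong suc (∣XΔ⁅x⁆∣-∉ (λ x∈X → x∉X (there x∈X)))
∣XΔ⁅x⁆∣-∉ {x = fsuc x} {false ∷ X} x∉X = ∣XΔ⁅x⁆∣-∉ (λ x∈X → x∉X (there x∈X))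

∣X∣≡suc⇒Nonempty : ∀ {n k} (X : Subset n) → ∣ X ∣ ≡ suc k → Nonempty X
∣X∣≡suc⇒Nonempty (true ∷ X) _ = fzero , here
∣X∣≡suc⇒Nonempty (false ∷ X) eq with ∣X∣≡suc⇒Nonempty X eq
... | x , x∈X = fsuc x , there x∈X

∣X∣≡0⇒X≡⊥ : ∀ {n} (X : Subset n) → ∣ X ∣ ≡ 0 → X ≡ ⊥
∣X∣≡0⇒X≡⊥ [] _ = ≡.refl
∣X∣≡0⇒X≡⊥ (false ∷ X) eq = ≡.cong (false ∷_) (∣X∣≡0⇒X≡⊥ X eq)

X⊆Y⇒∣XΔY∣+∣X∣≡∣Y∣ : ∀ {n} (X Y : Subset n) → X ⊆ Y → ∣ X Δ Y ∣ ℕ.+ ∣ X ∣ ≡ ∣ Y ∣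
X⊆Y⇒∣XΔY∣+∣X∣≡∣Y∣ [] [] _ = ≡.refl
X⊆Y⇒∣XΔY∣+∣X∣≡∣Y∣ (true ∷ X) (true ∷ Y) X⊆Y = ≡.trans (Nat.+-suc _ _) (≡.cong suc (X⊆Y⇒∣XΔY∣+∣X∣≡∣Y∣ X Y (drop-∷-⊆ X⊆Y)))
X⊆Y⇒∣XΔY∣+∣X∣≡∣Y∣ (true ∷ X) (false ∷ Y) X⊆Y with () ← X⊆Y here
X⊆Y⇒∣XΔY∣+∣X∣≡∣Y∣ (false ∷ X) (true ∷ Y) X⊆Y = ≡.cong suc (X⊆Y⇒∣XΔY∣+∣X∣≡∣Y∣ X Y (drop-∷-⊆ X⊆Y))
X⊆Y⇒∣XΔY∣+∣X∣≡∣Y∣ (false ∷ X) (false ∷ Y) X⊆Y = X⊆Y⇒∣XΔY∣+∣X∣≡∣Y∣ X Y (drop-∷-⊆ X⊆Y)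

find-or-all : ∀ {n a b} {Q : Fin n → Set a} {R : Fin n → Set b} → (∀ i → Q i ⊎ R i) → Σ (Fin n) Q ⊎ (∀ i → R i)
find-or-all {zero} _ = inj₂ (λ ())
find-or-all {suc n} Q⊎R with Q⊎R fzero | find-or-all (Q⊎R ∘ fsuc)
... | inj₁ q | _ = inj₁ (fzero , q)
... | inj₂ _ | inj₁ (i , q) = inj₁ (fsuc i , q)
... | inj₂ r | inj₂ rs = inj₂ (λ { fzero → r ; (fsuc i) → rs i })

module ExteriorAlgebra {c ℓ} (R : CommutativeRing c ℓ) where
  open CommutativeRing R
  open import Algebra.Properties.Ring ring
    using (-‿distribˡ-*; -‿distribʳ-*; -‿involutive; -‿injective; -0#≈0#; +-inverseʳ-unique; -‿+-comm; +-cancelˡ; +-cancelʳ)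
  open import Algebra.Properties.CommutativeSemigroup +-commutativeSemigroup using (interchange)
  open import Algebra.Properties.CommutativeSemigroup *-commutativeSemigroup using (x∙yz≈y∙xz)
  open import Algebra.Properties.Semiring.Sum semiring
    using (sum; sum-cong-≋; ∑-distrib-+; ∑-comm; *-distribˡ-sum; *-distribʳ-sum; sum-replicate-zero)
  open import Relation.Binary.Reasoning.Setoid setoid

  x≈0⇒-x≈0 : ∀ {x} → x ≈ 0# → - x ≈ 0#
  x≈0⇒-x≈0 x≈0 = trans (-‿cong x≈0) -0#≈0#

  -x≈0⇒x≈0 : ∀ {x} → - x ≈ 0# → x ≈ 0#
  -x≈0⇒x≈0 -x≈0 = trans (sym (-‿involutive _)) (x≈0⇒-x≈0 -x≈0)

  x≈0⇒x*y≈0 : ∀ {x y} → x ≈ 0# → x * y ≈ 0#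
  x≈0⇒x*y≈0 x≈0 = trans (*-congʳ x≈0) (zeroˡ _)

  y≈0⇒x*y≈0 : ∀ {x y} → y ≈ 0# → x * y ≈ 0#
  y≈0⇒x*y≈0 y≈0 = trans (*-congˡ y≈0) (zeroʳ _)

  x≈0⇒x+y≈y : ∀ {x y} → x ≈ 0# → x + y ≈ y
  x≈0⇒x+y≈y x≈0 = trans (+-congʳ x≈0) (+-identityˡ _)

  y≈0⇒x+y≈x : ∀ {x y} → y ≈ 0# → x + y ≈ x
  y≈0⇒x+y≈x y≈0 = trans (+-congˡ y≈0) (+-identityʳ _)

  x+y≈z⇒x≈z-y : ∀ {x y z} → x + y ≈ z → x ≈ z + - y
  x+y≈z⇒x≈z-y {x} {y} {z} x+y≈z = begin
    x                ≈⟨ y≈0⇒x+y≈x (-‿inverseʳ y) ⟨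
    x + (y + - y)    ≈⟨ +-assoc x y (- y) ⟨
    (x + y) + - y    ≈⟨ +-congʳ x+y≈z ⟩
    z + - y          ∎

  sgn : Bool → Carrier → Carrier
  sgn false x = x
  sgn true x = - x

  sgn-cong : ∀ b {x y} → x ≈ y → sgn b x ≈ sgn b y
  sgn-cong false x≈y = x≈y
  sgn-cong true x≈y = -‿cong x≈y

  sgn-distrib-+ : ∀ b x y → sgn b (x + y) ≈ sgn b x + sgn b y
  sgn-distrib-+ false x y = refl
  sgn-distrib-+ true x y = sym (-‿+-comm x y)

  sgn-*ˡ : ∀ b x y → sgn b x * y ≈ sgn b (x * y)
  sgn-*ˡ false x y = refl
  sgn-*ˡ true x y = sym (-‿distribˡ-* x y)

  sgn-*ʳ : ∀ b x y → x * sgn b y ≈ sgn b (x * y)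
  sgn-*ʳ false x y = refl
  sgn-*ʳ true x y = sym (-‿distribʳ-* x y)

  sgn-involutive : ∀ b x → sgn b (sgn b x) ≈ x
  sgn-involutive false x = refl
  sgn-involutive true x = -‿involutive x

  sgn-xor : ∀ b b′ x → sgn b (sgn b′ x) ≈ sgn (b xor b′) x
  sgn-xor false b′ x = refl
  sgn-xor true false x = refl
  sgn-xor true true x = -‿involutive x

  sgn-*-sgn : ∀ b b′ x y → sgn b x * sgn b′ y ≈ sgn (b xor b′) (x * y)
  sgn-*-sgn b b′ x y = trans (sgn-*ˡ b x _) (trans (sgn-cong b (sgn-*ʳ b′ x y)) (sgn-xor b b′ _))

  sgn-preserves-0 : ∀ b {x} → x ≈ 0# → sgn b x ≈ 0#
  sgn-preserves-0 false x≈0 = x≈0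
  sgn-preserves-0 true x≈0 = x≈0⇒-x≈0 x≈0

  sgn-injective : ∀ b {x y} → sgn b x ≈ sgn b y → x ≈ y
  sgn-injective b {x} {y} eq = begin
    x                 ≈⟨ sgn-involutive b x ⟨
    sgn b (sgn b x)   ≈⟨ sgn-cong b eq ⟩
    sgn b (sgn b y)   ≈⟨ sgn-involutive b y ⟩
    y                 ∎

  sum-zero : ∀ {n} {f : Fin n → Carrier} → (∀ i → f i ≈ 0#) → sum f ≈ 0#
  sum-zero {n} f≈0 = trans (sum-cong-≋ f≈0) (sum-replicate-zero n)

  sum-sgn : ∀ {n} b (f : Fin n → Carrier) → sum (λ i → sgn b (f i)) ≈ sgn b (sum f)
  sum-sgn {zero} b f = sym (sgn-preserves-0 b refl)
  sum-sgn {suc n} b f = trans (+-congˡ (sum-sgn b (f ∘ fsuc))) (sym (sgn-distrib-+ b _ _))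

  ∑∑-antisymmetric : ∀ {n} (F : Fin n → Fin n → Carrier) →
                     (∀ i → F i i ≈ 0#) → (∀ i j → F i j + F j i ≈ 0#) →
                     sum (λ i → sum (λ j → F i j)) ≈ 0#
  ∑∑-antisymmetric {zero} F diag anti = refl
  ∑∑-antisymmetric {suc n} F diag anti = begin
    (F₀₀ + sum F₀) + sum (λ i → F (fsuc i) fzero + sum (F (fsuc i) ∘ fsuc))
      ≈⟨ +-cong (x≈0⇒x+y≈y (diag fzero)) (∑-distrib-+ (λ i → F (fsuc i) fzero) _) ⟩
    sum F₀ + (sum (λ i → F (fsuc i) fzero) + sum (λ i → sum (F (fsuc i) ∘ fsuc)))
      ≈⟨ +-assoc _ _ _ ⟨
    (sum F₀ + sum (λ i → F (fsuc i) fzero)) + sum (λ i → sum (F (fsuc i) ∘ fsuc))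
      ≈⟨ +-cong (trans (sym (∑-distrib-+ F₀ _)) (sum-zero (λ j → anti fzero (fsuc j))))
                (∑∑-antisymmetric (λ i j → F (fsuc i) (fsuc j)) (diag ∘ fsuc) (λ i j → anti (fsuc i) (fsuc j))) ⟩
    0# + 0#
      ≈⟨ +-identityˡ 0# ⟩
    0# ∎
    where
    F₀₀ = F fzero fzero
    F₀ = F fzero ∘ fsuc

  δ : ∀ {n} → Fin n → Fin n → Carrier
  δ fzero fzero = 1#
  δ fzero (fsuc j) = 0#
  δ (fsuc i) fzero = 0#
  δ (fsuc i) (fsuc j) = δ i j

  sum-δ : ∀ {n} (i : Fin n) (f : Fin n → Carrier) → sum (λ j → δ i j * f j) ≈ f i
  sum-δ fzero f = trans (+-cong (*-identityˡ _) (sum-zero (λ j → zeroˡ (f (fsuc j))))) (+-identityʳ _)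
  sum-δ (fsuc i) f = trans (x≈0⇒x+y≈y (zeroˡ _)) (sum-δ i (f ∘ fsuc))

  -- f J is the coefficient of e_J = e_{j₁} ∧ … ∧ e_{jₖ} (j₁ < … < jₖ) in the exterior algebra of Rⁿ
  Λ : ℕ → Set c
  Λ n = Subset n → Carrier

  -- exterior product e_y ∧ _ and contraction with the dual basis vector e_y*
  ε ι : ∀ {n} → Fin n → Λ n → Λ n
  ε fzero f (true ∷ s) = f (false ∷ s)
  ε fzero f (false ∷ s) = 0#
  ε (fsuc y) f (b ∷ s) = sgn b (ε y (λ t → f (b ∷ t)) s)
  ι fzero f (true ∷ s) = 0#
  ι fzero f (false ∷ s) = f (true ∷ s)
  ι (fsuc y) f (b ∷ s) = sgn b (ι y (λ t → f (b ∷ t)) s)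

  record IsScaledEvaluation {n} (L : Λ n → Carrier) : Set (c ⊔ ℓ) where
    field
      scale : Carrier
      point : Subset n
      eval  : ∀ f → L f ≈ scale * f point

    cong : ∀ {f g} → (∀ t → f t ≈ g t) → L f ≈ L g
    cong {f} {g} f≈g = trans (eval f) (trans (*-congˡ (f≈g point)) (sym (eval g)))

    +-homo : ∀ f g → L (λ t → f t + g t) ≈ L f + L g
    +-homo f g = trans (eval _) (trans (distribˡ scale _ _) (+-cong (sym (eval f)) (sym (eval g))))

    *-homo : ∀ a f → L (λ t → a * f t) ≈ a * L f
    *-homo a f = trans (eval _) (trans (x∙yz≈y∙xz scale a _) (*-congˡ (sym (eval f))))

    sgn-homo : ∀ b f → L (λ t → sgn b (f t)) ≈ sgn b (L f)
    sgn-homo b f = trans (eval _) (trans (sgn-*ʳ b scale _) (sgn-cong b (sym (eval f))))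

    sgn-cancel : ∀ b f → sgn b (L (λ t → sgn b (f t))) ≈ L f
    sgn-cancel b f = trans (sgn-cong b (sgn-homo b f)) (sgn-involutive b _)

    vanishes : ∀ {f} → (∀ t → f t ≈ 0#) → L f ≈ 0#
    vanishes f≈0 = trans (eval _) (y≈0⇒x*y≈0 (f≈0 point))

    sum-homo : ∀ {m} (F : Fin m → Λ n) → L (λ t → sum (λ j → F j t)) ≈ sum (λ j → L (F j))
    sum-homo {zero} F = vanishes (λ _ → refl)
    sum-homo {suc m} F = trans (+-homo (F fzero) _) (+-congˡ (sum-homo (F ∘ fsuc)))

  ε-isScaledEvaluation : ∀ {n} (y : Fin n) s → IsScaledEvaluation (λ f → ε y f s)
  ε-isScaledEvaluation fzero (true ∷ s) = record { scale = 1# ; point = false ∷ s ; eval = λ f → sym (*-identityˡ _) }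
  ε-isScaledEvaluation fzero (false ∷ s) = record { scale = 0# ; point = false ∷ s ; eval = λ f → sym (zeroˡ _) }
  ε-isScaledEvaluation (fsuc y) (b ∷ s) = record
    { scale = sgn b scale ; point = b ∷ point
    ; eval = λ f → trans (sgn-cong b (eval (λ t → f (b ∷ t)))) (sym (sgn-*ˡ b scale _)) }
    where open IsScaledEvaluation (ε-isScaledEvaluation y s)

  ι-isScaledEvaluation : ∀ {n} (y : Fin n) s → IsScaledEvaluation (λ f → ι y f s)
  ι-isScaledEvaluation fzero (true ∷ s) = record { scale = 0# ; point = false ∷ s ; eval = λ f → sym (zeroˡ _) }
  ι-isScaledEvaluation fzero (false ∷ s) = record { scale = 1# ; point = true ∷ s ; eval = λ f → sym (*-identityˡ _) }
  ι-isScaledEvaluation (fsuc y) (b ∷ s) = record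
    { scale = sgn b scale ; point = b ∷ point
    ; eval = λ f → trans (sgn-cong b (eval (λ t → f (b ∷ t)))) (sym (sgn-*ˡ b scale _)) }
    where open IsScaledEvaluation (ι-isScaledEvaluation y s)

  module ε-linear {n} (y : Fin n) s = IsScaledEvaluation (ε-isScaledEvaluation y s)
  module ι-linear {n} (y : Fin n) s = IsScaledEvaluation (ι-isScaledEvaluation y s)

  ε-nilpotent : ∀ {n} (y : Fin n) f s → ε y (ε y f) s ≈ 0#
  ε-nilpotent fzero f (true ∷ s) = refl
  ε-nilpotent fzero f (false ∷ s) = refl
  ε-nilpotent (fsuc y) f (b ∷ s) = trans (ε-linear.sgn-cancel y s b _) (ε-nilpotent y (λ t → f (b ∷ t)) s)

  ε-anticomm : ∀ {n} (y z : Fin n) f s → ε y (ε z f) s + ε z (ε y f) s ≈ 0#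
  ε-anticomm fzero fzero f s = trans (y≈0⇒x+y≈x (ε-nilpotent fzero f s)) (ε-nilpotent fzero f s)
  ε-anticomm fzero (fsuc z) f (true ∷ s) = -‿inverseʳ _
  ε-anticomm fzero (fsuc z) f (false ∷ s) = trans (+-identityˡ _) (ε-linear.vanishes z s (λ _ → refl))
  ε-anticomm (fsuc y) fzero f (true ∷ s) = -‿inverseˡ _
  ε-anticomm (fsuc y) fzero f (false ∷ s) = trans (+-identityʳ _) (ε-linear.vanishes y s (λ _ → refl))
  ε-anticomm (fsuc y) (fsuc z) f (b ∷ s) =
    trans (+-cong (ε-linear.sgn-cancel y s b _) (ε-linear.sgn-cancel z s b _)) (ε-anticomm y z (λ t → f (b ∷ t)) s)

  ι-anticomm : ∀ {n} (y z : Fin n) f s → ι y (ι z f) s + ι z (ι y f) s ≈ 0#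
  ι-anticomm fzero fzero f (true ∷ s) = +-identityʳ _
  ι-anticomm fzero fzero f (false ∷ s) = +-identityʳ _
  ι-anticomm fzero (fsuc z) f (true ∷ s) = trans (+-identityˡ _) (x≈0⇒-x≈0 (ι-linear.vanishes z s (λ _ → refl)))
  ι-anticomm fzero (fsuc z) f (false ∷ s) = -‿inverseˡ _
  ι-anticomm (fsuc y) fzero f (true ∷ s) = trans (+-identityʳ _) (x≈0⇒-x≈0 (ι-linear.vanishes y s (λ _ → refl)))
  ι-anticomm (fsuc y) fzero f (false ∷ s) = -‿inverseʳ _
  ι-anticomm (fsuc y) (fsuc z) f (b ∷ s) =
    trans (+-cong (ι-linear.sgn-cancel y s b _) (ι-linear.sgn-cancel z s b _)) (ι-anticomm y z (λ t → f (b ∷ t)) s)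

  ι-ε-anticomm : ∀ {n} (i y : Fin n) f s → ι i (ε y f) s + ε y (ι i f) s ≈ δ i y * f s
  ι-ε-anticomm fzero fzero f (true ∷ s) = trans (+-identityˡ _) (sym (*-identityˡ _))
  ι-ε-anticomm fzero fzero f (false ∷ s) = trans (+-identityʳ _) (sym (*-identityˡ _))
  ι-ε-anticomm fzero (fsuc y) f (true ∷ s) =
    trans (+-identityˡ _) (trans (x≈0⇒-x≈0 (ε-linear.vanishes y s (λ _ → refl))) (sym (zeroˡ _)))
  ι-ε-anticomm fzero (fsuc y) f (false ∷ s) = trans (-‿inverseˡ _) (sym (zeroˡ _))
  ι-ε-anticomm (fsuc i) fzero f (true ∷ s) = trans (-‿inverseˡ _) (sym (zeroˡ _))
  ι-ε-anticomm (fsuc i) fzero f (false ∷ s) =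
    trans (+-identityʳ _) (trans (ι-linear.vanishes i s (λ _ → refl)) (sym (zeroˡ _)))
  ι-ε-anticomm (fsuc i) (fsuc y) f (b ∷ s) =
    trans (+-cong (ι-linear.sgn-cancel i s b _) (ε-linear.sgn-cancel y s b _)) (ι-ε-anticomm i y (λ t → f (b ∷ t)) s)

  sgn-sgn-∷ : ∀ {n} b′ b {s : Subset n} {y} (f : Λ (suc n)) →
              sgn b′ (sgn b (f (b′ ∷ (s Δ ⁅ y ⁆)))) ≈ sgn (b′ xor b) (f ((b′ ∷ s) Δ ⁅ fsuc y ⁆))
  sgn-sgn-∷ b′ b {s} {y} f = trans (sgn-xor b′ b _)
    (reflexive (≡.cong (λ x → sgn (b′ xor b) (f (x ∷ (s Δ ⁅ y ⁆)))) (≡.sym (xor-identityʳ b′))))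

  ε-∈ : ∀ {n} {y : Fin n} {s} → y ∈ s → Σ Bool λ b → ∀ f → ε y f s ≈ sgn b (f (s Δ ⁅ y ⁆))
  ε-∈ {s = true ∷ s} here = false , λ f → reflexive (≡.cong (λ X → f (false ∷ X)) (≡.sym (Δ-identityʳ s)))
  ε-∈ {y = fsuc y} {b′ ∷ s} (there y∈s) with ε-∈ y∈s
  ... | b , eq = b′ xor b , λ f → trans (sgn-cong b′ (eq (λ t → f (b′ ∷ t)))) (sgn-sgn-∷ b′ b f)

  ι-∉ : ∀ {n} {y : Fin n} {s} → y ∉ s → Σ Bool λ b → ∀ f → ι y f s ≈ sgn b (f (s Δ ⁅ y ⁆))
  ι-∉ {y = fzero} {true ∷ s} y∉s with () ← y∉s here
  ι-∉ {y = fzero} {false ∷ s} _ = false , λ f → reflexive (≡.cong (λ X → f (true ∷ X)) (≡.sym (Δ-identityʳ s)))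
  ι-∉ {y = fsuc y} {b′ ∷ s} y∉s with ι-∉ (λ y∈s → y∉s (there y∈s))
  ... | b , eq = b′ xor b , λ f → trans (sgn-cong b′ (eq (λ t → f (b′ ∷ t)))) (sgn-sgn-∷ b′ b f)

  ε-∉ : ∀ {n} {y : Fin n} {s} → y ∉ s → ∀ f → ε y f s ≈ 0#
  ε-∉ {y = fzero} {true ∷ s} y∉s with () ← y∉s here
  ε-∉ {y = fzero} {false ∷ s} _ f = refl
  ε-∉ {y = fsuc y} {b ∷ s} y∉s f = sgn-preserves-0 b (ε-∉ (λ y∈s → y∉s (there y∈s)) _)

  ε-local : ∀ {n} (y : Fin n) s {f g : Λ n} → (∀ t → suc ∣ t ∣ ≡ ∣ s ∣ → f t ≈ g t) → ε y f s ≈ ε y g s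
  ε-local fzero (true ∷ s) f≈g = f≈g (false ∷ s) ≡.refl
  ε-local fzero (false ∷ s) f≈g = refl
  ε-local (fsuc y) (true ∷ s) f≈g = -‿cong (ε-local y s (λ t eq → f≈g (true ∷ t) (≡.cong suc eq)))
  ε-local (fsuc y) (false ∷ s) f≈g = ε-local y s (λ t eq → f≈g (false ∷ t) eq)

  ι-determines : ∀ {n} {x : Fin n} {J} → x ∈ J → ∀ {f g : Λ n} → ι x f (J Δ ⁅ x ⁆) ≈ ι x g (J Δ ⁅ x ⁆) → f J ≈ g J
  ι-determines {x = x} {J} x∈J {f} {g} ιf≈ιg with ι-∉ (x∈X⇒x∉XΔ⁅x⁆ x∈J)
  ... | b , ι≈ = ≡.subst (λ X → f X ≈ g X) (Δ-involutive J ⁅ x ⁆) (sgn-injective b (trans (sym (ι≈ f)) (trans ιf≈ιg (ι≈ g))))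

  ∑ι⊥ε-singleton : ∀ {n} (g h : Λ n) K → ∣ K ∣ ≡ 1 → sum (λ l → ι l g ⊥ * ε l h K) ≈ g K * h ⊥
  ∑ι⊥ε-singleton g h (true ∷ s) eq with ∣X∣≡0⇒X≡⊥ s (≡.cong pred eq)
  ... | ≡.refl = y≈0⇒x+y≈x (sum-zero {f = λ l → ι (fsuc l) g ⊥ * ε (fsuc l) h (true ∷ ⊥)}
                                      (λ l → y≈0⇒x*y≈0 (x≈0⇒-x≈0 (ε-∉ {y = l} ∉⊥ _))))
  ∑ι⊥ε-singleton g h (false ∷ s) eq =
    trans (x≈0⇒x+y≈y (zeroʳ _)) (∑ι⊥ε-singleton (λ t → g (false ∷ t)) (λ t → h (false ∷ t)) s eq)

  infixr 7 _∧_

  _∧_ : ∀ {n} → (Fin n → Carrier) → Λ n → Λ n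
  (u ∧ f) s = sum (λ y → u y * ε y f s)

  ∧-cong : ∀ {n} (u : Fin n → Carrier) {f g : Λ n} → (∀ t → f t ≈ g t) → ∀ s → (u ∧ f) s ≈ (u ∧ g) s
  ∧-cong u f≈g s = sum-cong-≋ (λ y → *-congˡ (ε-linear.cong y s f≈g))

  ∧-+-homo : ∀ {n} (u : Fin n → Carrier) (f g : Λ n) s → (u ∧ (λ t → f t + g t)) s ≈ (u ∧ f) s + (u ∧ g) s
  ∧-+-homo u f g s = trans (sum-cong-≋ (λ y → trans (*-congˡ (ε-linear.+-homo y s f g)) (distribˡ _ _ _)))
                           (∑-distrib-+ (λ y → u y * ε y f s) _)

  ∧-*-homo : ∀ {n} (u : Fin n → Carrier) a (f : Λ n) s → (u ∧ (λ t → a * f t)) s ≈ a * (u ∧ f) s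
  ∧-*-homo u a f s = trans (sum-cong-≋ (λ y → trans (*-congˡ (ε-linear.*-homo y s a f)) (x∙yz≈y∙xz _ _ _)))
                           (sym (*-distribˡ-sum a (λ y → u y * ε y f s)))

  ∧-sgn-homo : ∀ {n} (u : Fin n → Carrier) b (f : Λ n) s → (u ∧ (λ t → sgn b (f t))) s ≈ sgn b ((u ∧ f) s)
  ∧-sgn-homo u b f s = trans (sum-cong-≋ (λ y → trans (*-congˡ (ε-linear.sgn-homo y s b f)) (sgn-*ʳ b _ _)))
                             (sum-sgn b (λ y → u y * ε y f s))

  ∑u*-ε≈-∧ : ∀ {n} (u : Fin n → Carrier) f s → sum (λ y → u y * - ε y f s) ≈ - (u ∧ f) s
  ∑u*-ε≈-∧ u f s = trans (sum-cong-≋ (λ y → sym (-‿distribʳ-* (u y) (ε y f s)))) (sum-sgn true (λ y → u y * ε y f s))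

  ε-∧-sum : ∀ {n} (i : Fin n) (u : Fin n → Carrier) f s → ε i (u ∧ f) s ≈ sum (λ z → u z * ε i (ε z f) s)
  ε-∧-sum i u f s = trans (ε-linear.sum-homo i s (λ z t → u z * ε z f t)) (sum-cong-≋ (λ z → ε-linear.*-homo i s (u z) (ε z f)))

  ∧∧-sum : ∀ {n} (u v : Fin n → Carrier) f s →
           (u ∧ v ∧ f) s ≈ sum (λ y → sum (λ z → u y * (v z * ε y (ε z f) s)))
  ∧∧-sum u v f s = sum-cong-≋ (λ y → trans (*-congˡ (ε-∧-sum y v f s)) (*-distribˡ-sum (u y) (λ z → v z * ε y (ε z f) s)))

  ∧∧-self : ∀ {n} (u : Fin n → Carrier) f s → (u ∧ u ∧ f) s ≈ 0#
  ∧∧-self u f s = trans (∧∧-sum u u f s) (∑∑-antisymmetric _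
    (λ y → y≈0⇒x*y≈0 (y≈0⇒x*y≈0 (ε-nilpotent y f s)))
    (λ y z → trans (+-congˡ (x∙yz≈y∙xz _ _ _))
               (trans (sym (distribˡ _ _ _)) (y≈0⇒x*y≈0 (trans (sym (distribˡ _ _ _)) (y≈0⇒x*y≈0 (ε-anticomm y z f s)))))))

  ∧∧-anticomm : ∀ {n} (u v : Fin n → Carrier) f s → (u ∧ v ∧ f) s ≈ - (v ∧ u ∧ f) s
  ∧∧-anticomm u v f s = +-inverseʳ-unique _ _ (begin
    (v ∧ u ∧ f) s + (u ∧ v ∧ f) s
      ≈⟨ +-cong (trans (∧∧-sum v u f s) (∑-comm (λ y z → v y * (u z * ε y (ε z f) s)))) (∧∧-sum u v f s) ⟩
    sum (λ y → sum (λ z → v z * (u y * ε z (ε y f) s))) + sum (λ y → sum (λ z → u y * (v z * ε y (ε z f) s)))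
      ≈⟨ ∑-distrib-+ (λ y → sum (λ z → v z * (u y * ε z (ε y f) s))) _ ⟨
    sum (λ y → sum (λ z → v z * (u y * ε z (ε y f) s)) + sum (λ z → u y * (v z * ε y (ε z f) s)))
      ≈⟨ sum-zero (λ y → trans (sym (∑-distrib-+ (λ z → v z * (u y * ε z (ε y f) s)) _)) (sum-zero (λ z → pair y z))) ⟩
    0# ∎)
    where
    pair : ∀ y z → v z * (u y * ε z (ε y f) s) + u y * (v z * ε y (ε z f) s) ≈ 0#
    pair y z = trans (+-congʳ (x∙yz≈y∙xz _ _ _)) (trans (sym (distribˡ _ _ _))
                 (y≈0⇒x*y≈0 (trans (sym (distribˡ _ _ _)) (y≈0⇒x*y≈0 (trans (+-comm _ _) (ε-anticomm y z f s))))))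

  ε-∧-anticomm : ∀ {n} (i : Fin n) (u : Fin n → Carrier) f s → ε i (u ∧ f) s ≈ - (u ∧ ε i f) s
  ε-∧-anticomm i u f s = +-inverseʳ-unique _ _ (begin
    (u ∧ ε i f) s + ε i (u ∧ f) s
      ≈⟨ +-congˡ (ε-∧-sum i u f s) ⟩
    sum (λ z → u z * ε z (ε i f) s) + sum (λ z → u z * ε i (ε z f) s)
      ≈⟨ ∑-distrib-+ (λ z → u z * ε z (ε i f) s) _ ⟨
    sum (λ z → u z * ε z (ε i f) s + u z * ε i (ε z f) s)
      ≈⟨ sum-zero (λ z → trans (sym (distribˡ _ _ _)) (y≈0⇒x*y≈0 (ε-anticomm z i f s))) ⟩
    0# ∎)

  ι-∧ : ∀ {n} (i : Fin n) (u : Fin n → Carrier) f s → ι i (u ∧ f) s ≈ u i * f s + - (u ∧ ι i f) s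
  ι-∧ i u f s = begin
    ι i (u ∧ f) s
      ≈⟨ trans (ι-linear.sum-homo i s (λ z t → u z * ε z f t)) (sum-cong-≋ (λ z → ι-linear.*-homo i s (u z) (ε z f))) ⟩
    sum (λ z → u z * ι i (ε z f) s)
      ≈⟨ sum-cong-≋ (λ z → trans (*-congˡ (x+y≈z⇒x≈z-y (ι-ε-anticomm i z f s)))
                          (trans (distribˡ _ _ _) (+-cong (x∙yz≈y∙xz _ _ _) (sym (-‿distribʳ-* _ _))))) ⟩
    sum (λ z → δ i z * (u z * f s) + - (u z * ε z (ι i f) s))
      ≈⟨ ∑-distrib-+ (λ z → δ i z * (u z * f s)) _ ⟩
    sum (λ z → δ i z * (u z * f s)) + sum (λ z → - (u z * ε z (ι i f) s))
      ≈⟨ +-cong (sum-δ i (λ z → u z * f s)) (sum-sgn true (λ z → u z * ε z (ι i f) s)) ⟩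
    u i * f s + - (u ∧ ι i f) s ∎

  -- Pfaffians

  Matrix : ℕ → Set c
  Matrix n = Fin n → Fin n → Carrier

  Skew : ∀ {n} → Matrix n → Set ℓ
  Skew A = ∀ i j → A i j ≈ - A j i

  dropFirst : ∀ {n} → Matrix (suc n) → Matrix n
  dropFirst A i j = A (fsuc i) (fsuc j)

  firstRow : ∀ {n} → Matrix (suc n) → Fin n → Carrier
  firstRow A j = A fzero (fsuc j)

  -- pfaffians A J = Pf(A_J): expanding along the first row, Pf(A_{{0} ∪ S}) is the coefficient of e_S in
  -- firstRow A ∧ pfaffians (dropFirst A)
  pfaffians : ∀ {n} → Matrix n → Λ n
  pfaffians {zero} A [] = 1#
  pfaffians {suc n} A (false ∷ s) = pfaffians (dropFirst A) s
  pfaffians {suc n} A (true ∷ s) = (firstRow A ∧ pfaffians (dropFirst A)) s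

  -[x-[w-m]]+m≈-x+w : ∀ x w m → - (x + - (w + - m)) + m ≈ - x + w
  -[x-[w-m]]+m≈-x+w x w m = begin
    - (x + - (w + - m)) + m   ≈⟨ +-congʳ (trans (sym (-‿+-comm _ _)) (+-congˡ (-‿involutive _))) ⟩
    (- x + (w + - m)) + m     ≈⟨ +-assoc _ _ _ ⟩
    - x + ((w + - m) + m)     ≈⟨ +-congˡ (trans (+-assoc _ _ _) (y≈0⇒x+y≈x (-‿inverseˡ m))) ⟩
    - x + w                   ∎

  -- Skewness only gives A i i + A i i ≈ 0#, so the diagonal term cannot be dropped.
  ∧-row-pfaffians : ∀ {n} (A : Matrix n) → Skew A → ∀ i K →
                    (A i ∧ pfaffians A) K ≈ ι i (pfaffians A) K + A i i * ε i (pfaffians A) K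
  ∧-row-pfaffians {suc n} A skew fzero (false ∷ s) = +-comm _ _
  ∧-row-pfaffians {suc n} A skew fzero (true ∷ s) = begin
    A fzero fzero * q′ s + sum (λ y → firstRow A y * - ε y (firstRow A ∧ q′) s)
      ≈⟨ y≈0⇒x+y≈x (trans (∑u*-ε≈-∧ (firstRow A) (firstRow A ∧ q′) s) (x≈0⇒-x≈0 (∧∧-self (firstRow A) q′ s))) ⟩
    A fzero fzero * q′ s
      ≈⟨ +-identityˡ _ ⟨
    0# + A fzero fzero * q′ s ∎
    where q′ = pfaffians (dropFirst A)
  ∧-row-pfaffians {suc n} A skew (fsuc i) (false ∷ s) =
    trans (x≈0⇒x+y≈y (zeroʳ _)) (∧-row-pfaffians (dropFirst A) (λ i j → skew (fsuc i) (fsuc j)) i s)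
  ∧-row-pfaffians {suc n} A skew (fsuc i) (true ∷ s) = trans lhs (sym rhs)
    where
    r = firstRow A
    u = dropFirst A i
    a = A (fsuc i) (fsuc i)
    q′ = pfaffians (dropFirst A)
    m = a * (r ∧ ε i q′) s
    lhs : A (fsuc i) fzero * q′ s + sum (λ y → u y * - ε y (r ∧ q′) s) ≈ - (r i * q′ s) + (r ∧ u ∧ q′) s
    lhs = +-cong (trans (*-congʳ (skew (fsuc i) fzero)) (sym (-‿distribˡ-* _ _)))
                 (begin
                   sum (λ y → u y * - ε y (r ∧ q′) s)   ≈⟨ ∑u*-ε≈-∧ u (r ∧ q′) s ⟩
                   - (u ∧ r ∧ q′) s                     ≈⟨ -‿cong (∧∧-anticomm u r q′ s) ⟩
                   - - (r ∧ u ∧ q′) s                   ≈⟨ -‿involutive _ ⟩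
                   (r ∧ u ∧ q′) s                       ∎)
    ι-q′ : ∀ t → ι i q′ t ≈ (u ∧ q′) t + - (a * ε i q′ t)
    ι-q′ t = x+y≈z⇒x≈z-y (sym (∧-row-pfaffians (dropFirst A) (λ i j → skew (fsuc i) (fsuc j)) i t))
    ∧-ι-q′ : (r ∧ ι i q′) s ≈ (r ∧ u ∧ q′) s + - m
    ∧-ι-q′ = begin
      (r ∧ ι i q′) s                                      ≈⟨ ∧-cong r ι-q′ s ⟩
      (r ∧ (λ t → (u ∧ q′) t + - (a * ε i q′ t))) s       ≈⟨ ∧-+-homo r (u ∧ q′) _ s ⟩
      (r ∧ u ∧ q′) s + (r ∧ (λ t → - (a * ε i q′ t))) s
        ≈⟨ +-congˡ (trans (∧-sgn-homo r true (λ t → a * ε i q′ t) s) (-‿cong (∧-*-homo r a (ε i q′) s))) ⟩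
      (r ∧ u ∧ q′) s + - m                                ∎
    rhs : - ι i (r ∧ q′) s + a * - ε i (r ∧ q′) s ≈ - (r i * q′ s) + (r ∧ u ∧ q′) s
    rhs = begin
      - ι i (r ∧ q′) s + a * - ε i (r ∧ q′) s
        ≈⟨ +-cong (-‿cong (trans (ι-∧ i r q′ s) (+-congˡ (-‿cong ∧-ι-q′))))
                  (*-congˡ (trans (-‿cong (ε-∧-anticomm i r q′ s)) (-‿involutive _))) ⟩
      - (r i * q′ s + - ((r ∧ u ∧ q′) s + - m)) + m
        ≈⟨ -[x-[w-m]]+m≈-x+w _ _ _ ⟩
      - (r i * q′ s) + (r ∧ u ∧ q′) s ∎

  ι-pfaffians : ∀ {n} (A : Matrix n) → Skew A → ∀ i K →
                ι i (pfaffians A) K ≈ (A i ∧ pfaffians A) K + - (A i i * ε i (pfaffians A) K)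
  ι-pfaffians A skew i K = x+y≈z⇒x≈z-y (sym (∧-row-pfaffians A skew i K))

  pfaffians-⊥ : ∀ {n} (A : Matrix n) → pfaffians A ⊥ ≈ 1#
  pfaffians-⊥ {zero} A = refl
  pfaffians-⊥ {suc n} A = pfaffians-⊥ (dropFirst A)

  pfaffians-odd : ∀ {n} (A : Matrix n) J → parity ∣ J ∣ ≡ 1ℙ → pfaffians A J ≈ 0#
  pfaffians-odd {suc n} A (false ∷ s) odd = pfaffians-odd (dropFirst A) s odd
  pfaffians-odd {suc n} A (true ∷ s) odd =
    sum-zero (λ y → y≈0⇒x*y≈0 (trans (ε-local y s (λ t eq → pfaffians-odd (dropFirst A) t (oddᵗ t eq)))
                                     (ε-linear.vanishes y s (λ _ → refl))))
    where
    oddᵗ : ∀ t → suc ∣ t ∣ ≡ ∣ s ∣ → parity ∣ t ∣ ≡ 1ℙ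
    oddᵗ t eq = ≡.trans (≡.cong (parity ∘ suc) eq) odd

  xᵀAy+yᵀAx≈0 : ∀ {n} (A : Matrix n) → Skew A → (x y : Fin n → Carrier) →
                sum (λ i → x i * sum (λ j → A i j * y j)) + sum (λ i → sum (λ j → A i j * x j) * y i) ≈ 0#
  xᵀAy+yᵀAx≈0 A skew x y = begin
    sum (λ i → x i * sum (λ j → A i j * y j)) + sum (λ i → sum (λ j → A i j * x j) * y i)
      ≈⟨ +-cong (sum-cong-≋ (λ i → *-distribˡ-sum (x i) (λ j → A i j * y j)))
                (trans (sum-cong-≋ (λ i → *-distribʳ-sum (y i) (λ j → A i j * x j))) (∑-comm (λ i j → A i j * x j * y i))) ⟩
    sum (λ i → sum (λ j → x i * (A i j * y j))) + sum (λ i → sum (λ j → A j i * x i * y j))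
      ≈⟨ ∑-distrib-+ (λ i → sum (λ j → x i * (A i j * y j))) _ ⟨
    sum (λ i → sum (λ j → x i * (A i j * y j)) + sum (λ j → A j i * x i * y j))
      ≈⟨ sum-zero (λ i → trans (sym (∑-distrib-+ (λ j → x i * (A i j * y j)) _)) (sum-zero (pair i))) ⟩
    0# ∎
    where
    pair : ∀ i j → x i * (A i j * y j) + A j i * x i * y j ≈ 0#
    pair i j = trans (+-cong (x∙yz≈y∙xz _ _ _) (*-assoc _ _ _))
                     (trans (sym (distribʳ _ _ _)) (x≈0⇒x*y≈0 (trans (+-congˡ (skew j i)) (-‿inverseʳ _))))

  x[w-ay]+[v-ax]y≈xw+vy : ∀ {a} x y w v → a + a ≈ 0# → x * (w + - (a * y)) + (v + - (a * x)) * y ≈ x * w + v * y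
  x[w-ay]+[v-ax]y≈xw+vy {a} x y w v a+a≈0 = begin
    x * (w + - (a * y)) + (v + - (a * x)) * y
      ≈⟨ +-cong (distribˡ _ _ _) (distribʳ _ _ _) ⟩
    (x * w + x * - (a * y)) + (v * y + - (a * x) * y)
      ≈⟨ interchange _ _ _ _ ⟩
    (x * w + v * y) + (x * - (a * y) + - (a * x) * y)
      ≈⟨ y≈0⇒x+y≈x (begin
           x * - (a * y) + - (a * x) * y        ≈⟨ +-cong (sym (-‿distribʳ-* _ _)) (sym (-‿distribˡ-* _ _)) ⟩
           - (x * (a * y)) + - (a * x * y)      ≈⟨ -‿+-comm _ _ ⟩
           - (x * (a * y) + a * x * y)          ≈⟨ -‿cong (+-cong (x∙yz≈y∙xz _ _ _) (*-assoc _ _ _)) ⟩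
           - (a * (x * y) + a * (x * y))        ≈⟨ -‿cong (sym (distribʳ _ _ _)) ⟩
           - ((a + a) * (x * y))                ≈⟨ x≈0⇒-x≈0 (x≈0⇒x*y≈0 a+a≈0) ⟩
           0#                                   ∎) ⟩
    x * w + v * y ∎

  Ω : ∀ {n} → Λ n → Λ n → Subset n → Subset n → Carrier
  Ω f g J₁ J₂ = sum (λ i → ε i f J₁ * ι i g J₂ + ι i f J₁ * ε i g J₂)

  Ω-pfaffians : ∀ {n} (A : Matrix n) → Skew A → ∀ J₁ J₂ → Ω (pfaffians A) (pfaffians A) J₁ J₂ ≈ 0#
  Ω-pfaffians A skew J₁ J₂ = begin
    Ω q q J₁ J₂
      ≈⟨ sum-cong-≋ (λ i → trans (+-cong (*-congˡ (ι-pfaffians A skew i J₂)) (*-congʳ (ι-pfaffians A skew i J₁)))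
                                 (x[w-ay]+[v-ax]y≈xw+vy _ _ _ _ (trans (+-congˡ (skew i i)) (-‿inverseʳ _)))) ⟩
    sum (λ i → ε i q J₁ * (A i ∧ q) J₂ + (A i ∧ q) J₁ * ε i q J₂)
      ≈⟨ ∑-distrib-+ (λ i → ε i q J₁ * (A i ∧ q) J₂) _ ⟩
    sum (λ i → ε i q J₁ * (A i ∧ q) J₂) + sum (λ i → (A i ∧ q) J₁ * ε i q J₂)
      ≈⟨ xᵀAy+yᵀAx≈0 A skew (λ i → ε i q J₁) (λ i → ε i q J₂) ⟩
    0# ∎
    where q = pfaffians A

  -- signedSum D t = Σ_{i ∈ D} (-1)^|{j ∈ D : j < i}| t i
  signedSum : ∀ {n} → Subset n → (Fin n → Carrier) → Carrier
  signedSum [] t = 0#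
  signedSum (b ∷ D) t = (if b then t fzero else 0#) + sgn b (signedSum D (t ∘ fsuc))

  wickTerm : ∀ {n} → Λ n → Λ n → Subset n → Subset n → Fin n → Carrier
  wickTerm f g J₁ J₂ i = f (J₁ Δ ⁅ i ⁆) * g (J₂ Δ ⁅ i ⁆)

  signedSum-cong : ∀ {n} (D : Subset n) {t t′ : Fin n → Carrier} → (∀ i → i ∈ D → t i ≈ t′ i) →
                    signedSum D t ≈ signedSum D t′
  signedSum-cong [] _ = refl
  signedSum-cong (true ∷ D) t≈t′ = +-cong (t≈t′ fzero here) (-‿cong (signedSum-cong D (λ i i∈D → t≈t′ (fsuc i) (there i∈D))))
  signedSum-cong (false ∷ D) t≈t′ = +-congˡ (signedSum-cong D (λ i i∈D → t≈t′ (fsuc i) (there i∈D)))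

  signedSum-determines : ∀ {n} (D : Subset n) {t t′ : Fin n → Carrier} {a} → a ∈ D →
                         (∀ i → i ∈ D → i ≢ a → t i ≈ t′ i) → signedSum D t ≈ signedSum D t′ → t a ≈ t′ a
  signedSum-determines (true ∷ D) {t} {t′} here t≈t′ eq =
    +-cancelʳ _ (t fzero) (t′ fzero)
      (trans eq (+-congˡ (-‿cong (signedSum-cong D (λ i i∈D → sym (t≈t′ (fsuc i) (there i∈D) λ ()))))))
  signedSum-determines (true ∷ D) (there a∈D) t≈t′ eq =
    signedSum-determines D a∈D (λ i i∈D i≢a → t≈t′ (fsuc i) (there i∈D) (i≢a ∘ fsuc-injective))
      (-‿injective (+-cancelˡ _ _ _ (trans (+-congʳ (sym (t≈t′ fzero here λ ()))) eq)))
  signedSum-determines (false ∷ D) (there a∈D) t≈t′ eq =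
    signedSum-determines D a∈D (λ i i∈D i≢a → t≈t′ (fsuc i) (there i∈D) (i≢a ∘ fsuc-injective))
      (+-cancelˡ _ _ _ eq)

  signedSum-zero : ∀ {n} (D : Subset n) → signedSum D (λ _ → 0#) ≈ 0#
  signedSum-zero [] = refl
  signedSum-zero (true ∷ D) = trans (+-identityˡ _) (x≈0⇒-x≈0 (signedSum-zero D))
  signedSum-zero (false ∷ D) = trans (+-identityˡ _) (signedSum-zero D)

  Ω-signedSum : ∀ {n} (f g : Λ n) J₁ J₂ → Ω f g J₁ J₂ ≈ signedSum (J₁ Δ J₂) (wickTerm f g J₁ J₂)
  Ω-signedSum f g [] [] = refl
  Ω-signedSum f g (b₁ ∷ s₁) (b₂ ∷ s₂) = +-cong (first b₁ b₂) rest
    where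
    f′ g′ : Λ _
    f′ t = f (b₁ ∷ t)
    g′ t = g (b₂ ∷ t)
    first : ∀ b₁ b₂ → ε fzero f (b₁ ∷ s₁) * ι fzero g (b₂ ∷ s₂) + ι fzero f (b₁ ∷ s₁) * ε fzero g (b₂ ∷ s₂)
                      ≈ (if b₁ xor b₂ then wickTerm f g (b₁ ∷ s₁) (b₂ ∷ s₂) fzero else 0#)
    first true true = trans (y≈0⇒x+y≈x (zeroˡ _)) (zeroʳ _)
    first true false = trans (y≈0⇒x+y≈x (zeroˡ _))
      (reflexive (≡.cong₂ (λ X Y → f (false ∷ X) * g (true ∷ Y)) (≡.sym (Δ-identityʳ s₁)) (≡.sym (Δ-identityʳ s₂))))
    first false true = trans (x≈0⇒x+y≈y (zeroˡ _))
      (reflexive (≡.cong₂ (λ X Y → f (true ∷ X) * g (false ∷ Y)) (≡.sym (Δ-identityʳ s₁)) (≡.sym (Δ-identityʳ s₂))))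
    first false false = trans (y≈0⇒x+y≈x (zeroʳ _)) (zeroˡ _)
    rest : sum (λ i → sgn b₁ (ε i f′ s₁) * sgn b₂ (ι i g′ s₂) + sgn b₁ (ι i f′ s₁) * sgn b₂ (ε i g′ s₂))
           ≈ sgn (b₁ xor b₂) (signedSum (s₁ Δ s₂) (wickTerm f g (b₁ ∷ s₁) (b₂ ∷ s₂) ∘ fsuc))
    rest = begin
      sum (λ i → sgn b₁ (ε i f′ s₁) * sgn b₂ (ι i g′ s₂) + sgn b₁ (ι i f′ s₁) * sgn b₂ (ε i g′ s₂))
        ≈⟨ sum-cong-≋ signs ⟩
      sum (λ i → sgn (b₁ xor b₂) (ε i f′ s₁ * ι i g′ s₂ + ι i f′ s₁ * ε i g′ s₂))
        ≈⟨ sum-sgn (b₁ xor b₂) (λ i → ε i f′ s₁ * ι i g′ s₂ + ι i f′ s₁ * ε i g′ s₂) ⟩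
      sgn (b₁ xor b₂) (Ω f′ g′ s₁ s₂)
        ≈⟨ sgn-cong (b₁ xor b₂) (Ω-signedSum f′ g′ s₁ s₂) ⟩
      sgn (b₁ xor b₂) (signedSum (s₁ Δ s₂) (wickTerm f′ g′ s₁ s₂))
        ≈⟨ sgn-cong (b₁ xor b₂) (signedSum-cong (s₁ Δ s₂) (λ i _ → reflexive
             (≡.cong₂ (λ x y → f (x ∷ (s₁ Δ ⁅ i ⁆)) * g (y ∷ (s₂ Δ ⁅ i ⁆)))
                      (≡.sym (xor-identityʳ b₁)) (≡.sym (xor-identityʳ b₂))))) ⟩
      sgn (b₁ xor b₂) (signedSum (s₁ Δ s₂) (wickTerm f g (b₁ ∷ s₁) (b₂ ∷ s₂) ∘ fsuc)) ∎
      where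
      signs : ∀ i → sgn b₁ (ε i f′ s₁) * sgn b₂ (ι i g′ s₂) + sgn b₁ (ι i f′ s₁) * sgn b₂ (ε i g′ s₂)
                    ≈ sgn (b₁ xor b₂) (ε i f′ s₁ * ι i g′ s₂ + ι i f′ s₁ * ε i g′ s₂)
      signs i = trans (+-cong (sgn-*-sgn b₁ b₂ _ _) (sgn-*-sgn b₁ b₂ _ _)) (sym (sgn-distrib-+ (b₁ xor b₂) _ _))

module WithPartialField {c ℓ g} (P : PartialField c ℓ g) where
  open PartialField P
  open PF P
  open ExteriorAlgebra commRing
  open import Algebra.Properties.Ring ring using (-‿distribˡ-*; -‿distribʳ-*; -1*x≈-x; +-inverseʳ-unique)
  open import Algebra.Properties.Semiring.Sum semiring using (sum; sum-cong-≋)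
  open import Relation.Binary.Reasoning.Setoid setoid

  alternatingSum : ∀ {n} → ℕ → List (Fin n) → (Fin n → Carrier) → Carrier
  alternatingSum j [] t = 0#
  alternatingSum j (i ∷ is) t = signPow j * t i + alternatingSum (suc j) is t

  alternatingSum-unique : ∀ {n} {t : Fin n → Carrier} (F : ℕ → List (Fin n) → Carrier) →
                          (∀ j → F j [] ≈ 0#) → (∀ j i is → F j (i ∷ is) ≈ signPow j * t i + F (suc j) is) →
                          ∀ j is → F j is ≈ alternatingSum j is t
  alternatingSum-unique F F[] F∷ j [] = F[] j
  alternatingSum-unique F F[] F∷ j (i ∷ is) = trans (F∷ j i is) (+-congˡ (alternatingSum-unique F F[] F∷ (suc j) is))

  -- wickSum is a local recursion `go 1 (elems (J₁ Δ J₂))`; abstracting its arguments after creating the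
  -- meta F lets unification solve F j is = go j is.
  wickSum-alternatingSum : ∀ {n} (p : Λ n) J₁ J₂ → wickSum p J₁ J₂ ≈ alternatingSum 1 (elems (J₁ Δ J₂)) (wickTerm p p J₁ J₂)
  wickSum-alternatingSum p J₁ J₂ with alternatingSum-unique {t = wickTerm p p J₁ J₂} _ | 1 | elems (J₁ Δ J₂)
  ... | unique | j | is = unique (λ _ → refl) (λ _ _ _ → refl) j is

  alternatingSum-map-fsuc : ∀ {n} j (is : List (Fin n)) t → alternatingSum j (map fsuc is) t ≈ alternatingSum j is (t ∘ fsuc)
  alternatingSum-map-fsuc j [] t = refl
  alternatingSum-map-fsuc j (i ∷ is) t = +-congˡ (alternatingSum-map-fsuc (suc j) is t)

  alternatingSum-elems : ∀ {n} j (D : Subset n) t → alternatingSum j (elems D) t ≈ signPow j * signedSum D t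
  alternatingSum-elems j [] t = sym (zeroʳ _)
  alternatingSum-elems j (true ∷ D) t = begin
    signPow j * t fzero + alternatingSum (suc j) (map fsuc (elems D)) t
      ≈⟨ +-congˡ (trans (alternatingSum-map-fsuc (suc j) (elems D) t) (alternatingSum-elems (suc j) D (t ∘ fsuc))) ⟩
    signPow j * t fzero + - signPow j * signedSum D (t ∘ fsuc)
      ≈⟨ +-congˡ (trans (sym (-‿distribˡ-* _ _)) (-‿distribʳ-* _ _)) ⟩
    signPow j * t fzero + signPow j * - signedSum D (t ∘ fsuc)
      ≈⟨ distribˡ _ _ _ ⟨
    signPow j * (t fzero + - signedSum D (t ∘ fsuc)) ∎
  alternatingSum-elems j (false ∷ D) t =
    trans (alternatingSum-map-fsuc j (elems D) t) (trans (alternatingSum-elems j D (t ∘ fsuc)) (*-congˡ (sym (+-identityˡ _))))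

  wickSum-signedSum : ∀ {n} (p : Λ n) J₁ J₂ → wickSum p J₁ J₂ ≈ - signedSum (J₁ Δ J₂) (wickTerm p p J₁ J₂)
  wickSum-signedSum p J₁ J₂ =
    trans (wickSum-alternatingSum p J₁ J₂)
          (trans (alternatingSum-elems 1 (J₁ Δ J₂) _) (trans (sym (-‿distribˡ-* _ _)) (-‿cong (*-identityˡ _))))

  wickSum-Ω : ∀ {n} (p : Λ n) J₁ J₂ → wickSum p J₁ J₂ ≈ - Ω p p J₁ J₂
  wickSum-Ω p J₁ J₂ = trans (wickSum-signedSum p J₁ J₂) (-‿cong (sym (Ω-signedSum p p J₁ J₂)))

  pfaffians-allWick : ∀ {n} (A : Matrix n) → Skew A → AllWick (pfaffians A)
  pfaffians-allWick A skew J₁ J₂ = trans (wickSum-Ω (pfaffians A) J₁ J₂) (x≈0⇒-x≈0 (Ω-pfaffians A skew J₁ J₂))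

  mutual
    pfFuel-map-fsuc : ∀ {n} (A : Matrix (suc n)) f (xs : List (Fin n)) → pfFuel A f (map fsuc xs) ≡ pfFuel (dropFirst A) f xs
    pfFuel-map-fsuc A f [] = ≡.refl
    pfFuel-map-fsuc A zero (x ∷ xs) = ≡.refl
    pfFuel-map-fsuc A (suc f) (x ∷ xs) = expand-map-fsuc A f x [] xs 0

    expand-map-fsuc : ∀ {n} (A : Matrix (suc n)) f x (pre post : List (Fin n)) k →
                      expand A f (fsuc x) (map fsuc pre) (map fsuc post) k ≡ expand (dropFirst A) f x pre post k
    expand-map-fsuc A f x pre [] k = ≡.refl
    expand-map-fsuc A f x pre (y ∷ post) k =
      ≡.cong₂ (λ a b → signPow k * (A (fsuc x) (fsuc y) * a) + b)
        (≡.trans (≡.cong (pfFuel A f) (≡.sym (map-++ fsuc pre post))) (pfFuel-map-fsuc A f (pre ++ post)))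
        (≡.trans (≡.cong (λ l → expand A f (fsuc x) l (map fsuc post) (suc k)) (≡.sym (map-++ fsuc pre (y ∷ []))))
                 (expand-map-fsuc A f x (pre ++ (y ∷ [])) post (suc k)))

  expand-∧ : ∀ {N m} (A : Matrix N) f x (pre : List (Fin N)) (h : Fin m → Fin N) (s : Subset m) k →
             expand A f x pre (map h (elems s)) k ≈ signPow k * ((A x ∘ h) ∧ (λ t → pfFuel A f (pre ++ map h (elems t)))) s
  expand-∧ A f x pre h [] k = sym (zeroʳ _)
  expand-∧ A f x pre h (true ∷ s) k = begin
    signPow k * a + expand A f x (pre ++ (h fzero ∷ [])) (map h (map fsuc (elems s))) (suc k)
      ≈⟨ +-congˡ (trans (reflexive (≡.cong (λ l → expand A f x (pre ++ (h fzero ∷ [])) l (suc k)) (≡.sym (map-∘ (elems s)))))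
                        (expand-∧ A f x (pre ++ (h fzero ∷ [])) (h ∘ fsuc) s (suc k))) ⟩
    signPow k * a + - signPow k * ((A x ∘ h ∘ fsuc) ∧ H′) s
      ≈⟨ +-congˡ (trans (sym (-‿distribˡ-* _ _)) (-‿distribʳ-* _ _)) ⟩
    signPow k * a + signPow k * - ((A x ∘ h ∘ fsuc) ∧ H′) s
      ≈⟨ +-congˡ (*-congˡ (-‿cong (∧-cong (A x ∘ h ∘ fsuc) (λ t → reflexive (H′≡H t)) s))) ⟩
    signPow k * a + signPow k * - ((A x ∘ h ∘ fsuc) ∧ (λ t → H (true ∷ t))) s
      ≈⟨ +-congˡ (*-congˡ (sym (∑u*-ε≈-∧ (A x ∘ h ∘ fsuc) (λ t → H (true ∷ t)) s))) ⟩
    signPow k * a + signPow k * sum (λ y → A x (h (fsuc y)) * - ε y (λ t → H (true ∷ t)) s)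
      ≈⟨ distribˡ _ _ _ ⟨
    signPow k * (a + sum (λ y → A x (h (fsuc y)) * - ε y (λ t → H (true ∷ t)) s)) ∎
    where
    H H′ : Subset _ → Carrier
    H t = pfFuel A f (pre ++ map h (elems t))
    H′ t = pfFuel A f ((pre ++ (h fzero ∷ [])) ++ map (h ∘ fsuc) (elems t))
    a = A x (h fzero) * H (false ∷ s)
    H′≡H : ∀ t → H′ t ≡ H (true ∷ t)
    H′≡H t = ≡.cong (pfFuel A f)
      (≡.trans (++-assoc pre (h fzero ∷ []) _) (≡.cong (λ l → pre ++ (h fzero ∷ l)) (map-∘ (elems t))))
  expand-∧ A f x pre h (false ∷ s) k = begin
    expand A f x pre (map h (map fsuc (elems s))) k
      ≈⟨ trans (reflexive (≡.cong (λ l → expand A f x pre l k) (≡.sym (map-∘ (elems s))))) (expand-∧ A f x pre (h ∘ fsuc) s k) ⟩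
    signPow k * ((A x ∘ h ∘ fsuc) ∧ (λ t → pfFuel A f (pre ++ map (h ∘ fsuc) (elems t)))) s
      ≈⟨ *-congˡ (trans (∧-cong (A x ∘ h ∘ fsuc) (λ t → reflexive (≡.cong (λ l → pfFuel A f (pre ++ l)) (map-∘ (elems t)))) s)
                        (sym (x≈0⇒x+y≈y (zeroʳ _)))) ⟩
    signPow k * (A x (h fzero) * 0# + ((A x ∘ h ∘ fsuc) ∧ (λ t → pfFuel A f (pre ++ map h (elems (false ∷ t))))) s) ∎

  pfFuel-pfaffians : ∀ {n} (A : Matrix n) f (J : Subset n) → ∣ J ∣ ≤ f → pfFuel A f (elems J) ≈ pfaffians A J
  pfFuel-pfaffians {zero} A f [] _ = refl
  pfFuel-pfaffians {suc n} A f (false ∷ s) ∣J∣≤f =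
    trans (reflexive (pfFuel-map-fsuc A f (elems s))) (pfFuel-pfaffians (dropFirst A) f s ∣J∣≤f)
  pfFuel-pfaffians {suc n} A (suc f) (true ∷ s) (s≤s ∣s∣≤f) = begin
    expand A f fzero [] (map fsuc (elems s)) 0
      ≈⟨ expand-∧ A f fzero [] fsuc s 0 ⟩
    1# * (firstRow A ∧ (λ t → pfFuel A f (map fsuc (elems t)))) s
      ≈⟨ *-identityˡ _ ⟩
    (firstRow A ∧ (λ t → pfFuel A f (map fsuc (elems t)))) s
      ≈⟨ sum-cong-≋ (λ y → *-congˡ (ε-local y s (λ t ∣t∣+1≡∣s∣ → trans (reflexive (pfFuel-map-fsuc A f (elems t)))
           (pfFuel-pfaffians (dropFirst A) f t (Nat.≤-trans (Nat.n≤1+n _) (Nat.≤-trans (Nat.≤-reflexive ∣t∣+1≡∣s∣) ∣s∣≤f)))))) ⟩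
    (firstRow A ∧ pfaffians (dropFirst A)) s ∎

  length-elems : ∀ {n} (J : Subset n) → length (elems J) ≡ ∣ J ∣
  length-elems [] = ≡.refl
  length-elems (true ∷ s) = ≡.cong suc (≡.trans (length-map fsuc (elems s)) (length-elems s))
  length-elems (false ∷ s) = ≡.trans (length-map fsuc (elems s)) (length-elems s)

  PfSub≈pfaffians : ∀ {n} (A : Matrix n) J → PfSub A J ≈ pfaffians A J
  PfSub≈pfaffians A J = pfFuel-pfaffians A (length (elems J)) J (Nat.≤-reflexive (≡.sym (length-elems J)))

  AllWick-resp : ∀ {n} {p p′ : Λ n} → (∀ J → p J ≈ p′ J) → AllWick p′ → AllWick p
  AllWick-resp {p = p} {p′} p≈p′ wick J₁ J₂ = begin
    wickSum p J₁ J₂                                     ≈⟨ wickSum-signedSum p J₁ J₂ ⟩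
    - signedSum (J₁ Δ J₂) (wickTerm p p J₁ J₂)
      ≈⟨ -‿cong (signedSum-cong (J₁ Δ J₂) (λ i _ → *-cong (p≈p′ _) (p≈p′ _))) ⟩
    - signedSum (J₁ Δ J₂) (wickTerm p′ p′ J₁ J₂)        ≈⟨ wickSum-signedSum p′ J₁ J₂ ⟨
    wickSum p′ J₁ J₂                                    ≈⟨ wick J₁ J₂ ⟩
    0#                                                  ∎

  -- Orthogonal matroids over P

  InP-sgn : ∀ b {x} → InP x → InP (sgn b x)
  InP-sgn false x∈P = x∈P
  InP-sgn true (inj₁ x∈G) = inj₁ (G-resp (-1*x≈-x _) (G-mul G-minusOne x∈G))
  InP-sgn true (inj₂ x≈0) = inj₂ (x≈0⇒-x≈0 x≈0)

  InP-* : ∀ {x y} → InP x → InP y → InP (x * y)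
  InP-* (inj₁ x∈G) (inj₁ y∈G) = inj₁ (G-mul x∈G y∈G)
  InP-* (inj₂ x≈0) _ = inj₂ (x≈0⇒x*y≈0 x≈0)
  InP-* (inj₁ _) (inj₂ y≈0) = inj₂ (y≈0⇒x*y≈0 y≈0)

  InP-ι : ∀ {n} {f : Λ n} → (∀ t → InP (f t)) → ∀ i K → InP (ι i f K)
  InP-ι f∈P fzero (true ∷ s) = inj₂ refl
  InP-ι f∈P fzero (false ∷ s) = f∈P (true ∷ s)
  InP-ι f∈P (fsuc i) (b ∷ s) = InP-sgn b (InP-ι (λ t → f∈P (b ∷ t)) i s)

  module Nontrivial (1≉0 : ¬ 1# ≈ 0#) where
    G⇒≉0 : ∀ {x} → G x → ¬ x ≈ 0#
    G⇒≉0 x∈G x≈0 with G-unit x∈G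
    ... | y , xy≈1 = 1≉0 (trans (sym xy≈1) (x≈0⇒x*y≈0 x≈0))

    InP⇒≉0⇒G : ∀ {x} → InP x → ¬ x ≈ 0# → G x
    InP⇒≉0⇒G (inj₁ x∈G) _ = x∈G
    InP⇒≉0⇒G (inj₂ x≈0) x≉0 with () ← x≉0 x≈0

    G-cancelˡ : ∀ {x a b} → G x → x * a ≈ x * b → a ≈ b
    G-cancelˡ {x} {a} {b} x∈G xa≈xb with G-inv x∈G
    ... | y , _ , xy≈1 = begin
      a             ≈⟨ *-identityˡ a ⟨
      1# * a        ≈⟨ *-congʳ (trans (*-comm y x) xy≈1) ⟨
      (y * x) * a   ≈⟨ *-assoc y x a ⟩
      y * (x * a)   ≈⟨ *-congˡ xa≈xb ⟩
      y * (x * b)   ≈⟨ *-assoc y x b ⟨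
      (y * x) * b   ≈⟨ *-congʳ (trans (*-comm y x) xy≈1) ⟩
      1# * b        ≈⟨ *-identityˡ b ⟩
      b             ∎

  IsPoint⇒1≉0 : ∀ {n} {p : Λ n} → IsPoint p → ¬ 1# ≈ 0#
  IsPoint⇒1≉0 {p = p} (_ , J , pJ≉0) 1≈0 = pJ≉0 (trans (sym (*-identityʳ (p J))) (y≈0⇒x*y≈0 1≈0))

  module _ {n} {p : Λ n} (p∈P : ∀ J → InP (p J)) (1≉0 : ¬ 1# ≈ 0#) where
    open Nontrivial 1≉0

    allWick⇒exchange : AllWick p → ∀ B₁ B₂ → Support p B₁ → Support p B₂ → ∀ x₁ → x₁ ∈ B₁ Δ B₂ →
                       ∃ λ x₂ → x₂ ∈ B₁ Δ B₂ × x₂ ≢ x₁ × Support p (B₁ Δ (⁅ x₁ ⁆ Δ ⁅ x₂ ⁆))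
    allWick⇒exchange wick B₁ B₂ B₁∈ℬ B₂∈ℬ x₁ x₁∈B₁ΔB₂ = conclude (find-or-all other-term)
      where
      J₁ = B₁ Δ ⁅ x₁ ⁆
      J₂ = B₂ Δ ⁅ x₁ ⁆
      t = wickTerm p p J₁ J₂
      D≡B₁ΔB₂ : J₁ Δ J₂ ≡ B₁ Δ B₂
      D≡B₁ΔB₂ = Δ-cancelʳ B₁ B₂ ⁅ x₁ ⁆

      other-term : ∀ i → (i ∈ B₁ Δ B₂ × i ≢ x₁ × G (t i)) ⊎ (i ∈ J₁ Δ J₂ → i ≢ x₁ → t i ≈ 0#)
      other-term i with i ∈? B₁ Δ B₂ | i ≟ x₁ | InP-* (p∈P (J₁ Δ ⁅ i ⁆)) (p∈P (J₂ Δ ⁅ i ⁆))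
      ... | no i∉D | _ | _ = inj₂ (λ i∈D _ → contradiction (≡.subst (i ∈_) D≡B₁ΔB₂ i∈D) i∉D)
      ... | yes _ | yes i≡x₁ | _ = inj₂ (λ _ i≢x₁ → contradiction i≡x₁ i≢x₁)
      ... | yes i∈D | no i≢x₁ | inj₁ tᵢ∈G = inj₁ (i∈D , i≢x₁ , tᵢ∈G)
      ... | yes _ | no _ | inj₂ tᵢ≈0 = inj₂ (λ _ _ → tᵢ≈0)

      x₁-term≈0 : (∀ i → i ∈ J₁ Δ J₂ → i ≢ x₁ → t i ≈ 0#) → p B₁ * p B₂ ≈ 0#
      x₁-term≈0 others≈0 = begin
        p B₁ * p B₂   ≡⟨ ≡.cong₂ (λ X Y → p X * p Y) (≡.sym (Δ-involutive B₁ ⁅ x₁ ⁆)) (≡.sym (Δ-involutive B₂ ⁅ x₁ ⁆)) ⟩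
        t x₁          ≈⟨ signedSum-determines (J₁ Δ J₂) (≡.subst (x₁ ∈_) (≡.sym D≡B₁ΔB₂) x₁∈B₁ΔB₂) others≈0 sums ⟩
        0#            ∎
        where
        sums : signedSum (J₁ Δ J₂) t ≈ signedSum (J₁ Δ J₂) (λ _ → 0#)
        sums = trans (-x≈0⇒x≈0 (trans (sym (wickSum-signedSum p J₁ J₂)) (wick J₁ J₂))) (sym (signedSum-zero (J₁ Δ J₂)))

      conclude : Σ (Fin n) (λ i → i ∈ B₁ Δ B₂ × i ≢ x₁ × G (t i)) ⊎ (∀ i → i ∈ J₁ Δ J₂ → i ≢ x₁ → t i ≈ 0#) →
                 ∃ λ x₂ → x₂ ∈ B₁ Δ B₂ × x₂ ≢ x₁ × Support p (B₁ Δ (⁅ x₁ ⁆ Δ ⁅ x₂ ⁆))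
      conclude (inj₁ (x₂ , x₂∈D , x₂≢x₁ , tₓ₂∈G)) =
        x₂ , x₂∈D , x₂≢x₁ , λ pB≈0 → G⇒≉0 tₓ₂∈G (x≈0⇒x*y≈0 (trans (reflexive (≡.cong p (Δ-assoc B₁ ⁅ x₁ ⁆ ⁅ x₂ ⁆))) pB≈0))
      conclude (inj₂ others≈0) =
        contradiction (x₁-term≈0 others≈0) (G⇒≉0 (G-mul (InP⇒≉0⇒G (p∈P B₁) B₁∈ℬ) (InP⇒≉0⇒G (p∈P B₂) B₂∈ℬ)))

  module WeakToPfaffian {n} {p : Λ n} (p∈P : ∀ J → InP (p J)) (1≉0 : ¬ 1# ≈ 0#) (p⊥≈1 : p ⊥ ≈ 1#)
                        (four : FourTermWick p) (om : IsOrthogonalMatroid (Support p)) where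
    open Nontrivial 1≉0

    support-down : ∀ J → Support p J → ∀ {x₁} → x₁ ∈ J →
                   ∃ λ x₂ → x₂ ∈ J Δ ⁅ x₁ ⁆ × Support p ((J Δ ⁅ x₁ ⁆) Δ ⁅ x₂ ⁆)
    support-down J J∈ℬ {x₁} x₁∈J
      with proj₂ om J ⊥ J∈ℬ (λ p⊥≈0 → 1≉0 (trans (sym p⊥≈1) p⊥≈0)) x₁ (≡.subst (x₁ ∈_) (≡.sym (Δ-identityʳ J)) x₁∈J)
    ... | x₂ , x₂∈J , x₂≢x₁ , J′∈ℬ =
      x₂ , y≢x⇒y∈X⇒y∈XΔ⁅x⁆ x₂≢x₁ (≡.subst (x₂ ∈_) (Δ-identityʳ J) x₂∈J) ,
      ≡.subst (Support p) (≡.sym (Δ-assoc J ⁅ x₁ ⁆ ⁅ x₂ ⁆)) J′∈ℬ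

    support-even : ∀ m J → ∣ J ∣ ≡ m → Support p J → parity m ≡ 0ℙ
    support-even zero J _ _ = ≡.refl
    support-even (suc m) J ∣J∣≡1+m J∈ℬ with ∣X∣≡suc⇒Nonempty J ∣J∣≡1+m
    ... | x₁ , x₁∈J with support-down J J∈ℬ x₁∈J
    ...   | x₂ , x₂∈K , K′∈ℬ with m | ∣XΔ⁅x⁆∣-∈ x₁∈J
    ...     | zero | ∣K∣+1≡∣J∣ =
      contradiction (≡.subst (x₂ ∈_) (∣X∣≡0⇒X≡⊥ (J Δ ⁅ x₁ ⁆) (Nat.suc-injective (≡.trans ∣K∣+1≡∣J∣ ∣J∣≡1+m))) x₂∈K) ∉⊥
    ...     | suc m′ | ∣K∣+1≡∣J∣ =
      support-even m′ _ (Nat.suc-injective (Nat.suc-injective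
        (≡.trans (≡.cong suc (∣XΔ⁅x⁆∣-∈ x₂∈K)) (≡.trans ∣K∣+1≡∣J∣ ∣J∣≡1+m)))) K′∈ℬ

    -- A i j = ± p {i, j}, with the sign that makes A skew
    A : Matrix n
    A i j = ι j (ι i p) ⊥

    A∈P : ∀ i j → InP (A i j)
    A∈P i j = InP-ι (InP-ι p∈P i) j ⊥

    A-skew : Skew A
    A-skew i j = +-inverseʳ-unique _ _ (ι-anticomm i j p ⊥)

    q : Λ n
    q = pfaffians A

    p≈q-odd : ∀ J → parity ∣ J ∣ ≡ 1ℙ → p J ≈ q J
    p≈q-odd J odd with p∈P J
    ... | inj₁ pJ∈G with () ← ≡.trans (≡.sym (support-even _ J ≡.refl (G⇒≉0 pJ∈G))) odd
    ... | inj₂ pJ≈0 = trans pJ≈0 (sym (pfaffians-odd A J odd))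

    ι-q-∉ : ∀ {x K} → x ∉ K → ι x q K ≈ (A x ∧ q) K
    ι-q-∉ {x} {K} x∉K = trans (ι-pfaffians A A-skew x K) (y≈0⇒x+y≈x (x≈0⇒-x≈0 (y≈0⇒x*y≈0 (ε-∉ x∉K q))))

    module Step (J : Subset n) (IH : ∀ {J′} → ∣ J′ ∣ < ∣ J ∣ → p J′ ≈ q J′) where
      ∧-q≈∧-p : ∀ u {K} → suc ∣ K ∣ ≡ ∣ J ∣ → (u ∧ q) K ≈ (u ∧ p) K
      ∧-q≈∧-p u {K} ∣K∣+1≡∣J∣ = sum-cong-≋ (λ l → *-congˡ (ε-local l K (λ t ∣t∣+1≡∣K∣ →
                                   sym (IH (Nat.<-trans (Nat.≤-reflexive ∣t∣+1≡∣K∣) (Nat.≤-reflexive ∣K∣+1≡∣J∣))))))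

      case-0 : ∣ J ∣ ≡ 0 → p J ≈ q J
      case-0 ∣J∣≡0 with ∣X∣≡0⇒X≡⊥ J ∣J∣≡0
      ... | ≡.refl = trans p⊥≈1 (sym (pfaffians-⊥ A))

      case-2 : ∣ J ∣ ≡ 2 → p J ≈ q J
      case-2 ∣J∣≡2 with ∣X∣≡suc⇒Nonempty J ∣J∣≡2
      ... | x , x∈J = sym (ι-determines x∈J (begin
        ι x q K                          ≈⟨ ι-q-∉ (x∈X⇒x∉XΔ⁅x⁆ x∈J) ⟩
        (A x ∧ q) K                      ≈⟨ ∧-q≈∧-p (A x) ∣K∣+1≡∣J∣ ⟩
        (A x ∧ p) K                      ≈⟨ ∑ι⊥ε-singleton (ι x p) p K (Nat.suc-injective (≡.trans ∣K∣+1≡∣J∣ ∣J∣≡2)) ⟩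
        ι x p K * p ⊥                    ≈⟨ trans (*-congˡ p⊥≈1) (*-identityʳ _) ⟩
        ι x p K                          ∎))
        where
        K = J Δ ⁅ x ⁆
        ∣K∣+1≡∣J∣ = ∣XΔ⁅x⁆∣-∈ x∈J

      q-vanishes : ∀ {x₁} → x₁ ∈ J → (∀ l → l ∈ J Δ ⁅ x₁ ⁆ → p ((J Δ ⁅ x₁ ⁆) Δ ⁅ l ⁆) ≈ 0#) → q J ≈ 0#
      q-vanishes {x₁} x₁∈J p≈0 = ι-determines x₁∈J {g = λ _ → 0#} (begin
        ι x₁ q K                 ≈⟨ ι-q-∉ (x∈X⇒x∉XΔ⁅x⁆ x₁∈J) ⟩
        (A x₁ ∧ q) K             ≈⟨ sum-zero (λ l → y≈0⇒x*y≈0 (ε-q≈0 l)) ⟩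
        0#                       ≈⟨ ι-linear.vanishes x₁ K (λ _ → refl) ⟨
        ι x₁ (λ _ → 0#) K        ∎)
        where
        K = J Δ ⁅ x₁ ⁆
        ε-q≈0 : ∀ l → ε l q K ≈ 0#
        ε-q≈0 l with l ∈? K
        ... | no l∉K = ε-∉ l∉K q
        ... | yes l∈K with ε-∈ l∈K
        ...   | b , ε≈ = trans (ε≈ q) (sgn-preserves-0 b (trans (sym (IH ∣KΔl∣<∣J∣)) (p≈0 l l∈K)))
          where ∣KΔl∣<∣J∣ = Nat.<-trans (Nat.≤-reflexive (∣XΔ⁅x⁆∣-∈ l∈K)) (Nat.≤-reflexive (∣XΔ⁅x⁆∣-∈ x₁∈J))

      four-term-step : ∀ {x₁} S → x₁ ∈ J → S ⊆ J Δ ⁅ x₁ ⁆ → ∣ J ∣ ≡ 4 ℕ.+ ∣ S ∣ → Support p S → p J ≈ q J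
      four-term-step {x₁} S x₁∈J S⊆K ∣J∣≡4+∣S∣ S∈ℬ = G-cancelˡ (InP⇒≉0⇒G (p∈P S) S∈ℬ) (begin
        p S * p J
          ≡⟨ ≡.cong₂ (λ X Y → p X * p Y) (≡.sym (Δ-involutive S ⁅ x₁ ⁆)) (≡.sym (Δ-involutive J ⁅ x₁ ⁆)) ⟩
        wickTerm p p J₁ K x₁
          ≈⟨ signedSum-determines D x₁∈D agree (trans (wick p (four J₁ K ∣D∣≡4)) (sym (wick q (pfaffians-allWick A A-skew J₁ K)))) ⟩
        wickTerm q q J₁ K x₁
          ≡⟨ ≡.cong₂ (λ X Y → q X * q Y) (Δ-involutive S ⁅ x₁ ⁆) (Δ-involutive J ⁅ x₁ ⁆) ⟩
        q S * q J
          ≈⟨ *-congʳ (IH ∣S∣<∣J∣) ⟨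
        p S * q J ∎)
        where
        K = J Δ ⁅ x₁ ⁆
        J₁ = S Δ ⁅ x₁ ⁆
        D = J₁ Δ K
        D≡SΔJ : D ≡ S Δ J
        D≡SΔJ = Δ-cancelʳ S J ⁅ x₁ ⁆
        ∣S∣<∣J∣ : ∣ S ∣ < ∣ J ∣
        ∣S∣<∣J∣ = ≡.subst (∣ S ∣ <_) (≡.sym ∣J∣≡4+∣S∣) (Nat.m<n+m ∣ S ∣ (s≤s z≤n))
        x₁∉S : x₁ ∉ S
        x₁∉S = x∈X⇒x∉XΔ⁅x⁆ x₁∈J ∘ S⊆K
        S⊆J : S ⊆ J
        S⊆J = x∈X⇒XΔ⁅x⁆⊆X x₁∈J ∘ S⊆K
        ∣D∣≡4 : ∣ D ∣ ≡ 4
        ∣D∣≡4 = ≡.trans (≡.cong ∣_∣ D≡SΔJ) (Nat.+-cancelʳ-≡ ∣ S ∣ _ 4 (≡.trans (X⊆Y⇒∣XΔY∣+∣X∣≡∣Y∣ S J S⊆J) ∣J∣≡4+∣S∣))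
        x₁∈D : x₁ ∈ D
        x₁∈D = ≡.subst (x₁ ∈_) (≡.sym D≡SΔJ) (x∉X⇒x∈Y⇒x∈XΔY x₁∉S x₁∈J)
        wick : ∀ f → wickSum f J₁ K ≈ 0# → signedSum D (wickTerm f f J₁ K) ≈ 0#
        wick f w = -x≈0⇒x≈0 (trans (sym (wickSum-signedSum f J₁ K)) w)
        agree : ∀ i → i ∈ D → i ≢ x₁ → wickTerm p p J₁ K i ≈ wickTerm q q J₁ K i
        agree i i∈D i≢x₁ with x∈XΔY⁻ S J (≡.subst (i ∈_) D≡SΔJ i∈D)
        ... | inj₁ (i∈S , i∉J) = contradiction (S⊆J i∈S) i∉J
        ... | inj₂ (i∉S , i∈J) = *-cong (IH ∣J₁Δi∣<∣J∣) (IH ∣KΔi∣<∣J∣)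
          where
          ∣J₁Δi∣≡2+∣S∣ : ∣ J₁ Δ ⁅ i ⁆ ∣ ≡ 2 ℕ.+ ∣ S ∣
          ∣J₁Δi∣≡2+∣S∣ = ≡.trans (∣XΔ⁅x⁆∣-∉ (i∉S ∘ y≢x⇒y∈XΔ⁅x⁆⇒y∈X i≢x₁)) (≡.cong suc (∣XΔ⁅x⁆∣-∉ x₁∉S))
          ∣J₁Δi∣<∣J∣ : ∣ J₁ Δ ⁅ i ⁆ ∣ < ∣ J ∣
          ∣J₁Δi∣<∣J∣ = ≡.subst₂ _<_ (≡.sym ∣J₁Δi∣≡2+∣S∣) (≡.sym ∣J∣≡4+∣S∣) (s≤s (s≤s (s≤s (Nat.n≤1+n _))))
          ∣KΔi∣<∣J∣ : ∣ K Δ ⁅ i ⁆ ∣ < ∣ J ∣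
          ∣KΔi∣<∣J∣ = Nat.<-trans (Nat.≤-reflexive (∣XΔ⁅x⁆∣-∈ (y≢x⇒y∈X⇒y∈XΔ⁅x⁆ i≢x₁ i∈J))) (Nat.≤-reflexive (∣XΔ⁅x⁆∣-∈ x₁∈J))

      module _ {k x₁} (∣J∣≡4+k : ∣ J ∣ ≡ 4 ℕ.+ k) (x₁∈J : x₁ ∈ J) where
        private K = J Δ ⁅ x₁ ⁆

        -- Two more exchange steps below K Δ x₂ reach a basis S ⊆ K with ∣ J ∣ ≡ 4 + ∣ S ∣.
        case-≥4-via : ∀ {x₂} → x₂ ∈ K → Support p (K Δ ⁅ x₂ ⁆) → p J ≈ q J
        case-≥4-via {x₂} x₂∈K J₂∈ℬ with ∣X∣≡suc⇒Nonempty J₂ ∣J₂∣≡2+k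
          where
          J₂ = K Δ ⁅ x₂ ⁆
          ∣J₂∣≡2+k : ∣ J₂ ∣ ≡ 2 ℕ.+ k
          ∣J₂∣≡2+k = Nat.suc-injective (Nat.suc-injective
                       (≡.trans (≡.cong suc (∣XΔ⁅x⁆∣-∈ x₂∈K)) (≡.trans (∣XΔ⁅x⁆∣-∈ x₁∈J) ∣J∣≡4+k)))
        ... | x₃ , x₃∈J₂ with support-down (K Δ ⁅ x₂ ⁆) J₂∈ℬ x₃∈J₂
        ...   | x₄ , x₄∈J₃ , S∈ℬ = four-term-step _ x₁∈J S⊆K ∣J∣≡4+∣S∣ S∈ℬ
          where
          S = ((K Δ ⁅ x₂ ⁆) Δ ⁅ x₃ ⁆) Δ ⁅ x₄ ⁆
          S⊆K : S ⊆ K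
          S⊆K = x∈X⇒XΔ⁅x⁆⊆X x₂∈K ∘ x∈X⇒XΔ⁅x⁆⊆X x₃∈J₂ ∘ x∈X⇒XΔ⁅x⁆⊆X x₄∈J₃
          ∣J∣≡4+∣S∣ : ∣ J ∣ ≡ 4 ℕ.+ ∣ S ∣
          ∣J∣≡4+∣S∣ = ≡.sym (≡.trans (≡.cong (3 ℕ.+_) (∣XΔ⁅x⁆∣-∈ x₄∈J₃)) (≡.trans (≡.cong (2 ℕ.+_) (∣XΔ⁅x⁆∣-∈ x₃∈J₂))
                        (≡.trans (≡.cong suc (∣XΔ⁅x⁆∣-∈ x₂∈K)) (∣XΔ⁅x⁆∣-∈ x₁∈J))))

        case-≥4 : p J ≈ q J
        case-≥4 with p∈P J
        ... | inj₁ pJ∈G with support-down J (G⇒≉0 pJ∈G) x₁∈J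
        ...   | x₂ , x₂∈K , J₂∈ℬ = case-≥4-via x₂∈K J₂∈ℬ
        case-≥4 | inj₂ pJ≈0 with find-or-all (λ l → support-or-zero l (l ∈? K))
          where
          support-or-zero : ∀ l → Dec (l ∈ K) → (l ∈ K × G (p (K Δ ⁅ l ⁆))) ⊎ (l ∈ K → p (K Δ ⁅ l ⁆) ≈ 0#)
          support-or-zero l (no l∉K) = inj₂ (λ l∈K → contradiction l∈K l∉K)
          support-or-zero l (yes l∈K) with p∈P (K Δ ⁅ l ⁆)
          ... | inj₁ pKΔl∈G = inj₁ (l∈K , pKΔl∈G)
          ... | inj₂ pKΔl≈0 = inj₂ (λ _ → pKΔl≈0)
        ... | inj₁ (x₂ , x₂∈K , pKΔx₂∈G) = case-≥4-via x₂∈K (G⇒≉0 pKΔx₂∈G)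
        ... | inj₂ p≈0 = trans pJ≈0 (sym (q-vanishes x₁∈J p≈0))

      p≈qᴶ : p J ≈ q J
      p≈qᴶ = by-size ∣ J ∣ ≡.refl
        where
        by-size : ∀ m → ∣ J ∣ ≡ m → p J ≈ q J
        by-size 0 = case-0
        by-size 1 ∣J∣≡1 = p≈q-odd J (≡.cong parity ∣J∣≡1)
        by-size 2 = case-2
        by-size 3 ∣J∣≡3 = p≈q-odd J (≡.cong parity ∣J∣≡3)
        by-size (suc (suc (suc (suc k)))) ∣J∣≡4+k with ∣X∣≡suc⇒Nonempty J ∣J∣≡4+k
        ... | x₁ , x₁∈J = case-≥4 ∣J∣≡4+k x₁∈J

    p≈q : ∀ J → p J ≈ q J
    p≈q = All.wfRec (On.wellFounded ∣_∣ <-wellFounded) _ (λ J → p J ≈ q J) (λ J IH → Step.p≈qᴶ J IH)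

    weak⇒pfaffianRep : PfaffianRep p
    weak⇒pfaffianRep = A , A∈P , A-skew , λ J → trans (p≈q J) (sym (PfSub≈pfaffians A J))

  pfaffianRep⇒strongOM : ∀ {n} {p : Λ n} → IsPoint p → PfaffianRep p → StrongOM p
  pfaffianRep⇒strongOM point (A , _ , skew , p≈PfSub) =
    point , AllWick-resp (λ J → trans (p≈PfSub J) (PfSub≈pfaffians A J)) (pfaffians-allWick A skew)

  strongOM⇒weakOM : ∀ {n} {p : Λ n} → StrongOM p → WeakOM p
  strongOM⇒weakOM (point@(p∈P , nonzero) , wick) =
    point , (λ J₁ J₂ _ → wick J₁ J₂) , nonzero , allWick⇒exchange p∈P (IsPoint⇒1≉0 point) wick

  weakOM⇒pfaffianRep : ∀ {n} {p : Λ n} → p ⊥ ≈ 1# → WeakOM p → PfaffianRep p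
  weakOM⇒pfaffianRep p⊥≈1 (point@(p∈P , _) , four , om) =
    WeakToPfaffian.weak⇒pfaffianRep p∈P (IsPoint⇒1≉0 point) p⊥≈1 four om

theorem4p2 : ∀ {c ℓ g} (P : PartialField c ℓ g) (n : ℕ)
    (p : Subset n → PartialField.Carrier P) →
    PF.IsPoint P p →
    PartialField._≈_ P (p ⊥) (PartialField.1# P) →
    (PF.PfaffianRep P p ⇔ PF.StrongOM P p) × (PF.StrongOM P p ⇔ PF.WeakOM P p)
theorem4p2 P n p point p⊥≈1 =
  mk⇔ (pfaffianRep⇒strongOM point) (λ strong → weakOM⇒pfaffianRep p⊥≈1 (strongOM⇒weakOM strong)) ,
  mk⇔ strongOM⇒weakOM (λ weak → pfaffianRep⇒strongOM point (weakOM⇒pfaffianRep p⊥≈1 weak))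
  where open WithPartialField P
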